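{- Let $m,n\ge1$ and let $\lambda$ be a partition of $n$ with $n_i$ parts equal to $i$ for each $i$, such that $n_1=0$ and there is exactly one odd integer $k\ge3$ with $n_k>0$. Let $l=\sum_i n_i$ and \[ \mu_\lambda(q)=\begin{bmatrix} m(n-1)+l\\ n_2,n_3,\dots,n_n,m(n-1)\end{bmatrix}_{q^2}\frac{[2n_k]_q}{[n_k]_q}. \] Let $d$ be a positive divisor of $2m(n-1)+2$ and $\zeta_d$ a primitive $d$-th root of unity. Then \[ \mu_\lambda(\zeta_d)=\begin{cases}2\binom{\frac{m(n-1)+1}{d}+\frac{l}{d}-1}{\frac{n_2}{d},\frac{n_3}{d},\dots,\frac{n_n}{d},\frac{m(n-1)+1}{d}-1} & \text{if } d \text{ is odd and } d\mid n_i \text{ for every } i,\\[2mm] 2\binom{\frac{2m(n-1)+2}{d}+\frac{2l}{d}-1}{\frac{2n_2}{d},\frac{2n_3}{d},\dots,\frac{2n_n}{d},\frac{2m(n-1)+2}{d}-1} & \text{if } d \text{ is even, } \frac d2\mid n_i \text{ for every } i, \text{ and } d\mid n_k,\\[2mm] 0 & \text{otherwise.}\end{cases} \]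
   Context: $[a]_q=1+q+\dots+q^{a-1}$, $[a]_q!=[1]_q\cdots[a]_q$, $\begin{bmatrix} N\\ a_1,\dots,a_r\end{bmatrix}_q=\frac{[N]_q!}{[a_1]_q!\cdots[a_r]_q!}$ for $\sum a_i=N$; the subscript $q^2$ means substituting $q^2$ for $q$. Unbracketed multinomials are ordinary. (In the paper, $\mu_\lambda$ is the sieving polynomial for faces of the $m$-cluster complex of type $D_n$ of parabolic type $\lambda$ in this case.) -}

module Defs where

open import Level using (Level)
open import Data.Nat as ℕ using (ℕ; zero; suc; _∸_; _%_; _≤_; _<_; _<?_; NonZero)
open import Data.Nat.Properties using (_!≢0; m*n≢0)
open import Data.Nat using (_!)
open import Data.Nat.ListAction using (sum; product)
open import Data.Integer as ℤ using (ℤ; +_; -[1+_])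
open import Data.List using (List; []; _∷_; [_]; map; foldr; replicate; reverse; length; _++_; upTo)
open import Data.Product using (Σ; _×_; _,_)
open import Data.Sum using (_⊎_)
open import Data.Nat.Divisibility using (_∣_)
open import Relation.Nullary using (¬_; yes; no)
open import Relation.Binary.PropositionalEquality using (_≡_)
open import Algebra.Bundles using (CommutativeRing)

-- Polynomials over ℤ, as coefficient lists (constant term first)

Poly : Set
Poly = List ℤ

infixl 6 _⊕_
infixl 7 _⊗_

_⊕_ : Poly → Poly → Poly
[] ⊕ q = q
(a ∷ p) ⊕ [] = a ∷ p
(a ∷ p) ⊕ (b ∷ q) = (a ℤ.+ b) ∷ (p ⊕ q)

scale : ℤ → Poly → Poly
scale c = map (c ℤ.*_)

_⊗_ : Poly → Poly → Poly
[] ⊗ q = []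
(a ∷ p) ⊗ q = scale a q ⊕ (+ 0 ∷ (p ⊗ q))

negP : Poly → Poly
negP = scale (ℤ.- (+ 1))

shiftP : ℕ → Poly → Poly
shiftP s p = replicate s (+ 0) ++ p

dropZeros : List ℤ → List ℤ
dropZeros [] = []
dropZeros (+ zero ∷ xs) = dropZeros xs
dropZeros (x ∷ xs) = x ∷ xs

trim : Poly → Poly
trim p = reverse (dropZeros (reverse p))

lead : List ℤ → ℤ
lead [] = + 0
lead (x ∷ []) = x
lead (x ∷ y ∷ xs) = lead (y ∷ xs)

divFuel : ℕ → Poly → Poly → Poly
divFuel zero f g = []
divFuel (suc fuel) f g with trim f
... | [] = []
... | (a ∷ f') with length (a ∷ f') <? length g
...   | yes _ = []
...   | no _ = t ⊕ divFuel fuel ((a ∷ f') ⊕ negP (t ⊗ g)) g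
  where t = shiftP (length (a ∷ f') ∸ length g) [ lead (a ∷ f') ]

-- exact quotient f / g for monic g dividing f
_÷_ : Poly → Poly → Poly
f ÷ g = divFuel (suc (length f)) f (trim g)

-- substitution q ↦ q²
sqP : Poly → Poly
sqP [] = []
sqP (a ∷ p) = a ∷ + 0 ∷ sqP p

qint : ℕ → Poly
qint a = replicate a (+ 1)

qfact : ℕ → Poly
qfact zero = [ + 1 ]
qfact (suc a) = qint (suc a) ⊗ qfact a

qmultinom : List ℕ → Poly
qmultinom as = qfact (sum as) ÷ foldr (λ a acc → qfact a ⊗ acc) [ + 1 ] as

factProd : List ℕ → ℕ
factProd as = product (map _! as)

factProd-nz : (as : List ℕ) → NonZero (factProd as)
factProd-nz [] = _
factProd-nz (a ∷ as) = m*n≢0 (a !) (factProd as) {{a !≢0}} {{factProd-nz as}}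

multinom : List ℕ → ℕ
multinom as = ℕ._/_ ((sum as) !) (factProd as) {{factProd-nz as}}

Odd : ℕ → Set
Odd k = k % 2 ≡ 1

Even : ℕ → Set
Even k = k % 2 ≡ 0

sumFrom1 : ℕ → (ℕ → ℕ) → ℕ
sumFrom1 zero f = 0
sumFrom1 (suc n) f = sumFrom1 n f ℕ.+ f (suc n)

from2 : ℕ → (ℕ → ℕ) → List ℕ
from2 n f = map (λ i → f (suc (suc i))) (upTo (n ∸ 1))

module _ {c ℓ : Level} (R : CommutativeRing c ℓ) where
  open CommutativeRing R

  natR : ℕ → Carrier
  natR zero = 0#
  natR (suc n) = 1# + natR n

  intR : ℤ → Carrier
  intR (+ n) = natR n
  intR -[1+ n ] = - natR (suc n)

  powR : Carrier → ℕ → Carrier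
  powR x zero = 1#
  powR x (suc n) = x * powR x n

  evalP : Poly → Carrier → Carrier
  evalP [] x = 0#
  evalP (a ∷ p) x = intR a + x * evalP p x

  PrimitiveRoot : ℕ → Carrier → Set ℓ
  PrimitiveRoot d ζ = (powR ζ d ≈ 1#) × ((j : ℕ) → 0 < j → j < d → ¬ (powR ζ j ≈ 1#))

  -- R is an integral domain of characteristic zero
  -- (no zero divisors; n·1 = 0 only for n = 0, which also gives 1 ≠ 0)
  DomainChar0 : Set (c Level.⊔ ℓ)
  DomainChar0 = ((a b : Carrier) → a * b ≈ 0# → (a ≈ 0#) ⊎ (b ≈ 0#))
              × ((k : ℕ) → natR k ≈ 0# → k ≡ 0)

-- The data of the lemma.  A partition λ of n is encoded by its
-- multiplicity function ν (ν i = n_i = number of parts equal to i),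
-- with Σ_{i=1}^{n} i·n_i = n.

numParts : ℕ → (ℕ → ℕ) → ℕ
numParts n ν = sumFrom1 n ν

-- μ_λ(q) = [ m(n-1)+l ; n_2,…,n_n, m(n-1) ]_{q²} · [2 n_k]_q / [n_k]_q
-- (the top entry of the q-multinomial is the sum of the bottom entries,
--  which is m(n-1)+l because n_1 = 0)
mu : (m n : ℕ) → (ν : ℕ → ℕ) → (k : ℕ) → Poly
mu m n ν k = sqP (qmultinom (from2 n ν ++ [ m ℕ.* (n ∸ 1) ]))
             ⊗ (qint (2 ℕ.* ν k) ÷ qint (ν k))

AllDiv : ℕ → ℕ → (ℕ → ℕ) → Set
AllDiv d n ν = (i : ℕ) → 1 ≤ i → i ≤ n → d ∣ ν i

Case1 : (m n : ℕ) → (ν : ℕ → ℕ) → (k d : ℕ) → Set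
Case1 m n ν k d = Odd d × AllDiv d n ν

Case2 : (m n : ℕ) → (ν : ℕ → ℕ) → (k d : ℕ) → Set
Case2 m n ν k d = Even d × AllDiv (d ℕ./ 2) n ν × (d ∣ ν k)

value1 : (m n : ℕ) → (ν : ℕ → ℕ) → (d : ℕ) → .{{NonZero d}} → ℕ
value1 m n ν d = 2 ℕ.* multinom (from2 n (λ i → ν i ℕ./ d)
                                 ++ [ (m ℕ.* (n ∸ 1) ℕ.+ 1) ℕ./ d ∸ 1 ])

value2 : (m n : ℕ) → (ν : ℕ → ℕ) → (d : ℕ) → .{{NonZero d}} → ℕ
value2 m n ν d = 2 ℕ.* multinom (from2 n (λ i → (2 ℕ.* ν i) ℕ./ d)
                                 ++ [ (2 ℕ.* (m ℕ.* (n ∸ 1)) ℕ.+ 2) ℕ./ d ∸ 1 ])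

{-# OPTIONS --safe #-}
-- Exact division by the monic denominator turns the q-multinomial into a product of Gaussian
-- binomials [a + b choose a]_q, and [2a]_q / [a]_q = 1 + q^a; hence
-- μ_λ(ζ) = ∏ [⋯]_ω · (1 + ζ^(n_k)) with ω = ζ², a primitive root of unity of order e = d for odd d
-- and e = d/2 for even d. Since e divides m(n-1)+1, the last entry m(n-1) is -1 modulo e. The
-- q-Lucas theorem [k₀ + k₁e + s₀ + s₁e choose k₀ + k₁e]_ω = C(k₁ + s₁, k₁) · [k₀ + s₀ choose k₀]_ω
-- (k₀, s₀ < e), together with the vanishing of the last factor when k₀ + s₀ ≥ e, shows that the
-- product is the ordinary multinomial of the quotients n_i/e when e divides every n_i, and 0
-- otherwise. Finally 1 + ζ^(n_k) is 2 when d divides n_k and 0 when only d/2 does.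

module Submission where

open import Defs

module Polynomials where

  open import Level using (0ℓ)
  open import Data.Integer as ℤ using (+_)
  import Data.Integer.Properties as ℤₚ
  open import Data.List using ([]; _∷_; [_])
  open import Data.Product using (_,_)
  open import Algebra.Bundles using (CommutativeRing)
  open import Relation.Binary.Bundles using (Setoid)
  open import Relation.Binary.Structures using (IsEquivalence)
  open import Relation.Binary.PropositionalEquality using (_≡_; refl; sym; trans; cong; cong₂)

  infix 4 _≈ₚ_
  infixr 5 _∷_

  -- Two coefficient lists denote the same polynomial when they agree up to trailing zeros.
  data _≈ₚ_ : Poly → Poly → Set where
    [] : [] ≈ₚ []
    _∷_ : ∀ {a b p q} → a ≡ b → p ≈ₚ q → a ∷ p ≈ₚ b ∷ q
    0∷≈[] : ∀ {a p} → a ≡ + 0 → p ≈ₚ [] → a ∷ p ≈ₚ []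
    []≈0∷ : ∀ {b q} → b ≡ + 0 → [] ≈ₚ q → [] ≈ₚ b ∷ q

  ≈ₚ-refl : ∀ {p} → p ≈ₚ p
  ≈ₚ-refl {[]} = []
  ≈ₚ-refl {a ∷ p} = refl ∷ ≈ₚ-refl

  ≈ₚ-sym : ∀ {p q} → p ≈ₚ q → q ≈ₚ p
  ≈ₚ-sym [] = []
  ≈ₚ-sym (a≡b ∷ p≈q) = sym a≡b ∷ ≈ₚ-sym p≈q
  ≈ₚ-sym (0∷≈[] a≡0 p≈[]) = []≈0∷ a≡0 (≈ₚ-sym p≈[])
  ≈ₚ-sym ([]≈0∷ b≡0 []≈q) = 0∷≈[] b≡0 (≈ₚ-sym []≈q)

  ≈ₚ-trans : ∀ {p q r} → p ≈ₚ q → q ≈ₚ r → p ≈ₚ r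
  ≈ₚ-trans [] q≈r = q≈r
  ≈ₚ-trans (a≡b ∷ p≈q) (b≡c ∷ q≈r) = trans a≡b b≡c ∷ ≈ₚ-trans p≈q q≈r
  ≈ₚ-trans (a≡b ∷ p≈q) (0∷≈[] b≡0 q≈[]) = 0∷≈[] (trans a≡b b≡0) (≈ₚ-trans p≈q q≈[])
  ≈ₚ-trans (0∷≈[] a≡0 p≈[]) ([]≈0∷ c≡0 []≈r) = trans a≡0 (sym c≡0) ∷ ≈ₚ-trans p≈[] []≈r
  ≈ₚ-trans (0∷≈[] a≡0 p≈[]) [] = 0∷≈[] a≡0 p≈[]
  ≈ₚ-trans ([]≈0∷ b≡0 []≈q) (b≡c ∷ q≈r) = []≈0∷ (trans (sym b≡c) b≡0) (≈ₚ-trans []≈q q≈r)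
  ≈ₚ-trans ([]≈0∷ b≡0 []≈q) (0∷≈[] _ _) = []

  ≡⇒≈ₚ : ∀ {p q} → p ≡ q → p ≈ₚ q
  ≡⇒≈ₚ refl = ≈ₚ-refl

  ≈ₚ-isEquivalence : IsEquivalence _≈ₚ_
  ≈ₚ-isEquivalence = record { refl = ≈ₚ-refl ; sym = ≈ₚ-sym ; trans = ≈ₚ-trans }

  ≈ₚ-setoid : Setoid 0ℓ 0ℓ
  ≈ₚ-setoid = record { isEquivalence = ≈ₚ-isEquivalence }

  open import Relation.Binary.Reasoning.Setoid ≈ₚ-setoid

  ⊕-identityʳ : ∀ p → p ⊕ [] ≡ p
  ⊕-identityʳ [] = refl
  ⊕-identityʳ (a ∷ p) = refl

  z≈[]⇒z⊕q≈q : ∀ {z} q → z ≈ₚ [] → z ⊕ q ≈ₚ q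
  z≈[]⇒z⊕q≈q q [] = ≈ₚ-refl
  z≈[]⇒z⊕q≈q [] (0∷≈[] a≡0 z≈[]) = 0∷≈[] a≡0 z≈[]
  z≈[]⇒z⊕q≈q (b ∷ q) (0∷≈[] a≡0 z≈[]) =
    trans (cong (ℤ._+ b) a≡0) (ℤₚ.+-identityˡ b) ∷ z≈[]⇒z⊕q≈q q z≈[]

  z≈[]⇒p⊕z≈p : ∀ p {z} → z ≈ₚ [] → p ⊕ z ≈ₚ p
  z≈[]⇒p⊕z≈p [] z≈[] = z≈[]
  z≈[]⇒p⊕z≈p (a ∷ p) [] = ≈ₚ-refl
  z≈[]⇒p⊕z≈p (a ∷ p) (0∷≈[] b≡0 z≈[]) =
    trans (cong (ℤ._+_ a) b≡0) (ℤₚ.+-identityʳ a) ∷ z≈[]⇒p⊕z≈p p z≈[]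

  ⊕-comm : ∀ p q → p ⊕ q ≈ₚ q ⊕ p
  ⊕-comm [] q = ≡⇒≈ₚ (sym (⊕-identityʳ q))
  ⊕-comm (a ∷ p) [] = ≈ₚ-refl
  ⊕-comm (a ∷ p) (b ∷ q) = ℤₚ.+-comm a b ∷ ⊕-comm p q

  ⊕-assoc : ∀ p q r → (p ⊕ q) ⊕ r ≈ₚ p ⊕ (q ⊕ r)
  ⊕-assoc [] q r = ≈ₚ-refl
  ⊕-assoc (a ∷ p) [] r = ≈ₚ-refl
  ⊕-assoc (a ∷ p) (b ∷ q) [] = ≈ₚ-refl
  ⊕-assoc (a ∷ p) (b ∷ q) (c ∷ r) = ℤₚ.+-assoc a b c ∷ ⊕-assoc p q r

  ⊕-cong : ∀ {p p′ q q′} → p ≈ₚ p′ → q ≈ₚ q′ → p ⊕ q ≈ₚ p′ ⊕ q′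
  ⊕-cong [] q≈q′ = q≈q′
  ⊕-cong (a≡b ∷ p≈p′) (c≡d ∷ q≈q′) = cong₂ ℤ._+_ a≡b c≡d ∷ ⊕-cong p≈p′ q≈q′
  ⊕-cong {p = a ∷ p} (a≡b ∷ p≈p′) (0∷≈[] c≡0 q≈[]) =
    ≈ₚ-trans (z≈[]⇒p⊕z≈p (a ∷ p) (0∷≈[] c≡0 q≈[])) (a≡b ∷ p≈p′)
  ⊕-cong {p′ = b ∷ p′} (a≡b ∷ p≈p′) [] = a≡b ∷ p≈p′
  ⊕-cong {p′ = b ∷ p′} {q′ = q′} (a≡b ∷ p≈p′) ([]≈0∷ d≡0 []≈q′) =
    ≈ₚ-trans (a≡b ∷ p≈p′) (≈ₚ-sym (z≈[]⇒p⊕z≈p (b ∷ p′) (0∷≈[] d≡0 (≈ₚ-sym []≈q′))))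
  ⊕-cong {q = q} (0∷≈[] a≡0 p≈[]) q≈q′ = ≈ₚ-trans (z≈[]⇒z⊕q≈q q (0∷≈[] a≡0 p≈[])) q≈q′
  ⊕-cong {q′ = q′} ([]≈0∷ b≡0 []≈p′) q≈q′ =
    ≈ₚ-trans q≈q′ (≈ₚ-sym (z≈[]⇒z⊕q≈q q′ (0∷≈[] b≡0 (≈ₚ-sym []≈p′))))

  ⊕-congˡ : ∀ p {q q′} → q ≈ₚ q′ → p ⊕ q ≈ₚ p ⊕ q′
  ⊕-congˡ p = ⊕-cong (≈ₚ-refl {p})

  ⊕-congʳ : ∀ q {p p′} → p ≈ₚ p′ → p ⊕ q ≈ₚ p′ ⊕ q
  ⊕-congʳ q p≈p′ = ⊕-cong p≈p′ (≈ₚ-refl {q})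

  ⊕-inverseʳ : ∀ p → p ⊕ negP p ≈ₚ []
  ⊕-inverseʳ [] = []
  ⊕-inverseʳ (a ∷ p) = 0∷≈[] (trans (cong (ℤ._+_ a) (ℤₚ.-1*i≡-i a)) (ℤₚ.+-inverseʳ a)) (⊕-inverseʳ p)

  ⊕-medial : ∀ p q r s → (p ⊕ q) ⊕ (r ⊕ s) ≈ₚ (p ⊕ r) ⊕ (q ⊕ s)
  ⊕-medial p q r s = begin
    (p ⊕ q) ⊕ (r ⊕ s)  ≈⟨ ⊕-assoc p q (r ⊕ s) ⟩
    p ⊕ (q ⊕ (r ⊕ s))  ≈⟨ ⊕-congˡ p (⊕-assoc q r s) ⟨
    p ⊕ ((q ⊕ r) ⊕ s)  ≈⟨ ⊕-congˡ p (⊕-congʳ s (⊕-comm q r)) ⟩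
    p ⊕ ((r ⊕ q) ⊕ s)  ≈⟨ ⊕-congˡ p (⊕-assoc r q s) ⟩
    p ⊕ (r ⊕ (q ⊕ s))  ≈⟨ ⊕-assoc p r (q ⊕ s) ⟨
    (p ⊕ r) ⊕ (q ⊕ s)  ∎

  scale-zeroʳ : ∀ c {z} → z ≈ₚ [] → scale c z ≈ₚ []
  scale-zeroʳ c [] = []
  scale-zeroʳ c (0∷≈[] a≡0 z≈[]) = 0∷≈[] (trans (cong (c ℤ.*_) a≡0) (ℤₚ.*-zeroʳ c)) (scale-zeroʳ c z≈[])

  scale-zeroˡ : ∀ p → scale (+ 0) p ≈ₚ []
  scale-zeroˡ [] = []
  scale-zeroˡ (a ∷ p) = 0∷≈[] refl (scale-zeroˡ p)

  scale-identityˡ : ∀ p → scale (+ 1) p ≈ₚ p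
  scale-identityˡ [] = []
  scale-identityˡ (a ∷ p) = ℤₚ.*-identityˡ a ∷ scale-identityˡ p

  scale-cong : ∀ c {p q} → p ≈ₚ q → scale c p ≈ₚ scale c q
  scale-cong c [] = []
  scale-cong c (a≡b ∷ p≈q) = cong (c ℤ.*_) a≡b ∷ scale-cong c p≈q
  scale-cong c (0∷≈[] a≡0 p≈[]) = scale-zeroʳ c (0∷≈[] a≡0 p≈[])
  scale-cong c ([]≈0∷ b≡0 []≈q) = ≈ₚ-sym (scale-zeroʳ c (0∷≈[] b≡0 (≈ₚ-sym []≈q)))

  scale-distrib-⊕ : ∀ c p q → scale c (p ⊕ q) ≈ₚ scale c p ⊕ scale c q
  scale-distrib-⊕ c [] q = ≈ₚ-refl
  scale-distrib-⊕ c (a ∷ p) [] = ≈ₚ-refl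
  scale-distrib-⊕ c (a ∷ p) (b ∷ q) = ℤₚ.*-distribˡ-+ c a b ∷ scale-distrib-⊕ c p q

  scale-distrib-+ : ∀ a b p → scale (a ℤ.+ b) p ≈ₚ scale a p ⊕ scale b p
  scale-distrib-+ a b [] = []
  scale-distrib-+ a b (x ∷ p) = ℤₚ.*-distribʳ-+ x a b ∷ scale-distrib-+ a b p

  scale-assoc : ∀ a b p → scale a (scale b p) ≈ₚ scale (a ℤ.* b) p
  scale-assoc a b [] = []
  scale-assoc a b (x ∷ p) = sym (ℤₚ.*-assoc a b x) ∷ scale-assoc a b p

  z≈[]⇒z⊗q≈[] : ∀ {z} q → z ≈ₚ [] → z ⊗ q ≈ₚ []
  z≈[]⇒z⊗q≈[] q [] = []
  z≈[]⇒z⊗q≈[] q (0∷≈[] {a} a≡0 z≈[]) = begin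
    scale a q ⊕ (+ 0 ∷ _)  ≈⟨ ⊕-cong a·q≈[] (0∷≈[] refl (z≈[]⇒z⊗q≈[] q z≈[])) ⟩
    [] ⊕ []                ∎
    where
    a·q≈[] : scale a q ≈ₚ []
    a·q≈[] = ≈ₚ-trans (≡⇒≈ₚ (cong (λ c → scale c q) a≡0)) (scale-zeroˡ q)

  ⊗-zeroʳ : ∀ p → p ⊗ [] ≈ₚ []
  ⊗-zeroʳ [] = []
  ⊗-zeroʳ (a ∷ p) = 0∷≈[] refl (⊗-zeroʳ p)

  0∷-⊗ : ∀ p r → (+ 0 ∷ p) ⊗ r ≈ₚ + 0 ∷ (p ⊗ r)
  0∷-⊗ p r = z≈[]⇒z⊕q≈q (+ 0 ∷ (p ⊗ r)) (scale-zeroˡ r)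

  ⊗-congʳ : ∀ q {p p′} → p ≈ₚ p′ → p ⊗ q ≈ₚ p′ ⊗ q
  ⊗-congʳ q [] = []
  ⊗-congʳ q (a≡b ∷ p≈p′) = ⊕-cong (≡⇒≈ₚ (cong (λ c → scale c q) a≡b)) (refl ∷ ⊗-congʳ q p≈p′)
  ⊗-congʳ q (0∷≈[] a≡0 p≈[]) = z≈[]⇒z⊗q≈[] q (0∷≈[] a≡0 p≈[])
  ⊗-congʳ q ([]≈0∷ b≡0 []≈p′) = ≈ₚ-sym (z≈[]⇒z⊗q≈[] q (0∷≈[] b≡0 (≈ₚ-sym []≈p′)))

  ⊗-congˡ : ∀ p {q q′} → q ≈ₚ q′ → p ⊗ q ≈ₚ p ⊗ q′
  ⊗-congˡ [] q≈q′ = []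
  ⊗-congˡ (a ∷ p) q≈q′ = ⊕-cong (scale-cong a q≈q′) (refl ∷ ⊗-congˡ p q≈q′)

  ⊗-cong : ∀ {p p′ q q′} → p ≈ₚ p′ → q ≈ₚ q′ → p ⊗ q ≈ₚ p′ ⊗ q′
  ⊗-cong {p′ = p′} {q = q} p≈p′ q≈q′ = ≈ₚ-trans (⊗-congʳ q p≈p′) (⊗-congˡ p′ q≈q′)

  ⊗-distribʳ-⊕ : ∀ r p q → (p ⊕ q) ⊗ r ≈ₚ p ⊗ r ⊕ q ⊗ r
  ⊗-distribʳ-⊕ r [] q = ≈ₚ-refl
  ⊗-distribʳ-⊕ r (a ∷ p) [] = ≈ₚ-sym (z≈[]⇒p⊕z≈p ((a ∷ p) ⊗ r) [])
  ⊗-distribʳ-⊕ r (a ∷ p) (b ∷ q) = begin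
    scale (a ℤ.+ b) r ⊕ (+ 0 ∷ ((p ⊕ q) ⊗ r))
      ≈⟨ ⊕-cong (scale-distrib-+ a b r) (refl ∷ ⊗-distribʳ-⊕ r p q) ⟩
    (scale a r ⊕ scale b r) ⊕ ((+ 0 ∷ (p ⊗ r)) ⊕ (+ 0 ∷ (q ⊗ r)))
      ≈⟨ ⊕-medial (scale a r) (scale b r) (+ 0 ∷ (p ⊗ r)) (+ 0 ∷ (q ⊗ r)) ⟩
    (a ∷ p) ⊗ r ⊕ (b ∷ q) ⊗ r ∎

  ⊗-distribˡ-⊕ : ∀ r p q → r ⊗ (p ⊕ q) ≈ₚ r ⊗ p ⊕ r ⊗ q
  ⊗-distribˡ-⊕ [] p q = []
  ⊗-distribˡ-⊕ (a ∷ r) p q = begin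
    scale a (p ⊕ q) ⊕ (+ 0 ∷ (r ⊗ (p ⊕ q)))
      ≈⟨ ⊕-cong (scale-distrib-⊕ a p q) (refl ∷ ⊗-distribˡ-⊕ r p q) ⟩
    (scale a p ⊕ scale a q) ⊕ ((+ 0 ∷ (r ⊗ p)) ⊕ (+ 0 ∷ (r ⊗ q)))
      ≈⟨ ⊕-medial (scale a p) (scale a q) (+ 0 ∷ (r ⊗ p)) (+ 0 ∷ (r ⊗ q)) ⟩
    (a ∷ r) ⊗ p ⊕ (a ∷ r) ⊗ q ∎

  scale-⊗ : ∀ a q r → scale a q ⊗ r ≈ₚ scale a (q ⊗ r)
  scale-⊗ a [] r = []
  scale-⊗ a (b ∷ q) r = begin
    scale (a ℤ.* b) r ⊕ (+ 0 ∷ (scale a q ⊗ r))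
      ≈⟨ ⊕-cong (≈ₚ-sym (scale-assoc a b r)) (sym (ℤₚ.*-zeroʳ a) ∷ scale-⊗ a q r) ⟩
    scale a (scale b r) ⊕ scale a (+ 0 ∷ (q ⊗ r))
      ≈⟨ scale-distrib-⊕ a (scale b r) (+ 0 ∷ (q ⊗ r)) ⟨
    scale a ((b ∷ q) ⊗ r) ∎

  ⊗-∷ʳ : ∀ p b q → p ⊗ (b ∷ q) ≈ₚ scale b p ⊕ (+ 0 ∷ (p ⊗ q))
  ⊗-∷ʳ [] b q = []≈0∷ refl []
  ⊗-∷ʳ (a ∷ p) b q = trans (ℤₚ.+-identityʳ (a ℤ.* b)) (trans (ℤₚ.*-comm a b) (sym (ℤₚ.+-identityʳ (b ℤ.* a))))
    ∷ (begin
      scale a q ⊕ (p ⊗ (b ∷ q))                 ≈⟨ ⊕-congˡ (scale a q) (⊗-∷ʳ p b q) ⟩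
      scale a q ⊕ (scale b p ⊕ (+ 0 ∷ (p ⊗ q)))  ≈⟨ ⊕-assoc (scale a q) (scale b p) _ ⟨
      (scale a q ⊕ scale b p) ⊕ (+ 0 ∷ (p ⊗ q))  ≈⟨ ⊕-congʳ _ (⊕-comm (scale a q) (scale b p)) ⟩
      (scale b p ⊕ scale a q) ⊕ (+ 0 ∷ (p ⊗ q))  ≈⟨ ⊕-assoc (scale b p) (scale a q) _ ⟩
      scale b p ⊕ (scale a q ⊕ (+ 0 ∷ (p ⊗ q)))  ∎)

  ⊗-comm : ∀ p q → p ⊗ q ≈ₚ q ⊗ p
  ⊗-comm [] q = ≈ₚ-sym (⊗-zeroʳ q)
  ⊗-comm (a ∷ p) q = begin
    scale a q ⊕ (+ 0 ∷ (p ⊗ q))  ≈⟨ ⊕-congˡ (scale a q) (refl ∷ ⊗-comm p q) ⟩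
    scale a q ⊕ (+ 0 ∷ (q ⊗ p))  ≈⟨ ⊗-∷ʳ q a p ⟨
    q ⊗ (a ∷ p)                  ∎

  ⊗-assoc : ∀ p q r → (p ⊗ q) ⊗ r ≈ₚ p ⊗ (q ⊗ r)
  ⊗-assoc [] q r = []
  ⊗-assoc (a ∷ p) q r = begin
    (scale a q ⊕ (+ 0 ∷ (p ⊗ q))) ⊗ r        ≈⟨ ⊗-distribʳ-⊕ r (scale a q) _ ⟩
    scale a q ⊗ r ⊕ (+ 0 ∷ (p ⊗ q)) ⊗ r      ≈⟨ ⊕-cong (scale-⊗ a q r) (0∷-⊗ (p ⊗ q) r) ⟩
    scale a (q ⊗ r) ⊕ (+ 0 ∷ ((p ⊗ q) ⊗ r))  ≈⟨ ⊕-congˡ (scale a (q ⊗ r)) (refl ∷ ⊗-assoc p q r) ⟩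
    (a ∷ p) ⊗ (q ⊗ r)                        ∎

  ⊗-identityˡ : ∀ p → [ + 1 ] ⊗ p ≈ₚ p
  ⊗-identityˡ p = ≈ₚ-trans (z≈[]⇒p⊕z≈p (scale (+ 1) p) (0∷≈[] refl [])) (scale-identityˡ p)

  ⊗-identityʳ : ∀ p → p ⊗ [ + 1 ] ≈ₚ p
  ⊗-identityʳ p = ≈ₚ-trans (⊗-comm p [ + 1 ]) (⊗-identityˡ p)

  Poly-commutativeRing : CommutativeRing 0ℓ 0ℓ
  Poly-commutativeRing = record
    { Carrier = Poly ; _≈_ = _≈ₚ_ ; _+_ = _⊕_ ; _*_ = _⊗_ ; -_ = negP ; 0# = [] ; 1# = [ + 1 ]
    ; isCommutativeRing = record
      { isRing = record
        { +-isAbelianGroup = record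
          { isGroup = record
            { isMonoid = record
              { isSemigroup = record
                { isMagma = record { isEquivalence = ≈ₚ-isEquivalence ; ∙-cong = ⊕-cong }
                ; assoc = ⊕-assoc
                }
              ; identity = (λ p → ≈ₚ-refl) , (λ p → ≡⇒≈ₚ (⊕-identityʳ p))
              }
            ; inverse = (λ p → ≈ₚ-trans (⊕-comm (negP p) p) (⊕-inverseʳ p)) , ⊕-inverseʳ
            ; ⁻¹-cong = scale-cong (ℤ.- (+ 1))
            }
          ; comm = ⊕-comm
          }
        ; *-cong = ⊗-cong
        ; *-assoc = ⊗-assoc
        ; *-identity = ⊗-identityˡ , ⊗-identityʳ
        ; distrib = ⊗-distribˡ-⊕ , ⊗-distribʳ-⊕
        }
      ; *-comm = ⊗-comm
      }
    }

module Evaluation where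

  open Polynomials using (_≈ₚ_; []; _∷_; 0∷≈[]; []≈0∷; ≈ₚ-sym)
  open import Level using (Level)
  open import Data.Nat as ℕ using (zero; suc)
  import Data.Nat.Properties as ℕₚ
  open import Data.Integer as ℤ using (+_; -[1+_]; _⊖_)
  import Data.Integer.Properties as ℤₚ
  open import Data.List using ([]; _∷_; [_])
  open import Algebra.Bundles using (CommutativeRing)
  import Algebra.Properties.Ring as RingProperties
  import Algebra.Solver.Ring.NaturalCoefficients.Default as NaturalCoefficientsSolver
  import Relation.Binary.PropositionalEquality as ≡

  module _ {c ℓ : Level} (R : CommutativeRing c ℓ) where

    open CommutativeRing R
    open RingProperties ring
    open import Relation.Binary.Reasoning.Setoid setoid
    open NaturalCoefficientsSolver commutativeSemiring using (solve; _:=_; _:+_; _:*_; con)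

    natR-+ : ∀ m n → natR R (m ℕ.+ n) ≈ natR R m + natR R n
    natR-+ zero n = sym (+-identityˡ _)
    natR-+ (suc m) n = trans (+-congˡ (natR-+ m n)) (sym (+-assoc _ _ _))

    natR-* : ∀ m n → natR R (m ℕ.* n) ≈ natR R m * natR R n
    natR-* zero n = sym (zeroˡ _)
    natR-* (suc m) n = begin
      natR R (n ℕ.+ m ℕ.* n)           ≈⟨ natR-+ n (m ℕ.* n) ⟩
      natR R n + natR R (m ℕ.* n)      ≈⟨ +-congˡ (natR-* m n) ⟩
      natR R n + natR R m * natR R n   ≈⟨ solve 2 (λ a b → a :+ b :* a := (con 1 :+ b) :* a) refl (natR R n) (natR R m) ⟩
      (1# + natR R m) * natR R n       ∎

    natR-1 : natR R 1 ≈ 1#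
    natR-1 = +-identityʳ 1#

    intR-⊖ : ∀ m n → intR R (m ⊖ n) ≈ natR R m - natR R n
    intR-⊖ zero zero = sym (-‿inverseʳ 0#)
    intR-⊖ (suc m) zero = sym (trans (+-congˡ -0#≈0#) (+-identityʳ _))
    intR-⊖ zero (suc n) = sym (+-identityˡ _)
    intR-⊖ (suc m) (suc n) = begin
      intR R (suc m ⊖ suc n)             ≡⟨ ≡.cong (intR R) (ℤₚ.[1+m]⊖[1+n]≡m⊖n m n) ⟩
      intR R (m ⊖ n)                     ≈⟨ intR-⊖ m n ⟩
      natR R m - natR R n                ≈⟨ cancel (natR R m) (natR R n) ⟨
      natR R (suc m) - natR R (suc n)    ∎
      where
      cancel : ∀ a b → (1# + a) - (1# + b) ≈ a - b
      cancel a b = begin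
        (1# + a) + - (1# + b)       ≈⟨ +-congˡ (-‿+-comm 1# b) ⟨
        (1# + a) + (- 1# + - b)     ≈⟨ solve 4 (λ o a no nb → (o :+ a) :+ (no :+ nb) := (o :+ no) :+ (a :+ nb)) refl 1# a (- 1#) (- b) ⟩
        (1# + - 1#) + (a + - b)     ≈⟨ +-congʳ (-‿inverseʳ 1#) ⟩
        0# + (a + - b)              ≈⟨ +-identityˡ _ ⟩
        a - b                       ∎

    intR-neg : ∀ i → intR R (ℤ.- i) ≈ - intR R i
    intR-neg -[1+ n ] = sym (-‿involutive _)
    intR-neg (+ zero) = sym -0#≈0#
    intR-neg (+ suc n) = refl

    intR-+ : ∀ i j → intR R (i ℤ.+ j) ≈ intR R i + intR R j
    intR-+ (+ m) (+ n) = natR-+ m n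
    intR-+ (+ m) -[1+ n ] = intR-⊖ m (suc n)
    intR-+ -[1+ m ] (+ n) = trans (intR-⊖ n (suc m)) (+-comm _ _)
    intR-+ -[1+ m ] -[1+ n ] = begin
      - natR R (suc (suc (m ℕ.+ n)))          ≡⟨ ≡.cong (λ k → - natR R (suc k)) (ℕₚ.+-suc m n) ⟨
      - natR R (suc m ℕ.+ suc n)              ≈⟨ -‿cong (natR-+ (suc m) (suc n)) ⟩
      - (natR R (suc m) + natR R (suc n))     ≈⟨ -‿+-comm _ _ ⟨
      - natR R (suc m) + - natR R (suc n)     ∎

    intR-[+n]* : ∀ n j → intR R (+ n ℤ.* j) ≈ natR R n * intR R j
    intR-[+n]* zero j = sym (zeroˡ _)
    intR-[+n]* (suc n) j = begin
      intR R (+ suc n ℤ.* j)              ≡⟨ ≡.cong (intR R) (ℤₚ.suc-* (+ n) j) ⟩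
      intR R (j ℤ.+ + n ℤ.* j)            ≈⟨ intR-+ j (+ n ℤ.* j) ⟩
      intR R j + intR R (+ n ℤ.* j)       ≈⟨ +-congˡ (intR-[+n]* n j) ⟩
      intR R j + natR R n * intR R j      ≈⟨ solve 2 (λ a b → a :+ b :* a := (con 1 :+ b) :* a) refl (intR R j) (natR R n) ⟩
      natR R (suc n) * intR R j           ∎

    intR-* : ∀ i j → intR R (i ℤ.* j) ≈ intR R i * intR R j
    intR-* (+ n) j = intR-[+n]* n j
    intR-* -[1+ n ] j = begin
      intR R (-[1+ n ] ℤ.* j)             ≡⟨ ≡.cong (intR R) (ℤₚ.neg-distribˡ-* (+ suc n) j) ⟨
      intR R (ℤ.- (+ suc n ℤ.* j))        ≈⟨ intR-neg (+ suc n ℤ.* j) ⟩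
      - intR R (+ suc n ℤ.* j)            ≈⟨ -‿cong (intR-[+n]* (suc n) j) ⟩
      - (natR R (suc n) * intR R j)       ≈⟨ -‿distribˡ-* _ _ ⟩
      - natR R (suc n) * intR R j         ∎

    evalP-⊕ : ∀ p q x → evalP R (p ⊕ q) x ≈ evalP R p x + evalP R q x
    evalP-⊕ [] q x = sym (+-identityˡ _)
    evalP-⊕ (a ∷ p) [] x = sym (+-identityʳ _)
    evalP-⊕ (a ∷ p) (b ∷ q) x = begin
      intR R (a ℤ.+ b) + x * evalP R (p ⊕ q) x
        ≈⟨ +-cong (intR-+ a b) (*-congˡ (evalP-⊕ p q x)) ⟩
      (intR R a + intR R b) + x * (evalP R p x + evalP R q x)
        ≈⟨ solve 5 (λ a b x P Q → (a :+ b) :+ x :* (P :+ Q) := (a :+ x :* P) :+ (b :+ x :* Q))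
                 refl (intR R a) (intR R b) x (evalP R p x) (evalP R q x) ⟩
      (intR R a + x * evalP R p x) + (intR R b + x * evalP R q x)
        ∎

    evalP-scale : ∀ c p x → evalP R (scale c p) x ≈ intR R c * evalP R p x
    evalP-scale c [] x = sym (zeroʳ _)
    evalP-scale c (a ∷ p) x = begin
      intR R (c ℤ.* a) + x * evalP R (scale c p) x
        ≈⟨ +-cong (intR-* c a) (*-congˡ (evalP-scale c p x)) ⟩
      intR R c * intR R a + x * (intR R c * evalP R p x)
        ≈⟨ solve 4 (λ c a x P → c :* a :+ x :* (c :* P) := c :* (a :+ x :* P)) refl (intR R c) (intR R a) x (evalP R p x) ⟩
      intR R c * (intR R a + x * evalP R p x)
        ∎

    evalP-⊗ : ∀ p q x → evalP R (p ⊗ q) x ≈ evalP R p x * evalP R q x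
    evalP-⊗ [] q x = sym (zeroˡ _)
    evalP-⊗ (a ∷ p) q x = begin
      evalP R (scale a q ⊕ (+ 0 ∷ (p ⊗ q))) x
        ≈⟨ evalP-⊕ (scale a q) _ x ⟩
      evalP R (scale a q) x + (0# + x * evalP R (p ⊗ q) x)
        ≈⟨ +-cong (evalP-scale a q x) (trans (+-identityˡ _) (*-congˡ (evalP-⊗ p q x))) ⟩
      intR R a * evalP R q x + x * (evalP R p x * evalP R q x)
        ≈⟨ solve 4 (λ a x P Q → a :* Q :+ x :* (P :* Q) := (a :+ x :* P) :* Q) refl (intR R a) x (evalP R p x) (evalP R q x) ⟩
      (intR R a + x * evalP R p x) * evalP R q x
        ∎

    evalP-zero : ∀ {z} x → z ≈ₚ [] → evalP R z x ≈ 0#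
    evalP-zero x [] = refl
    evalP-zero x (0∷≈[] ≡.refl z≈[]) = trans (+-identityˡ _) (trans (*-congˡ (evalP-zero x z≈[])) (zeroʳ _))

    evalP-cong : ∀ {p q} x → p ≈ₚ q → evalP R p x ≈ evalP R q x
    evalP-cong x [] = refl
    evalP-cong x (≡.refl ∷ p≈q) = +-congˡ (*-congˡ (evalP-cong x p≈q))
    evalP-cong x (0∷≈[] a≡0 p≈[]) = evalP-zero x (0∷≈[] a≡0 p≈[])
    evalP-cong x ([]≈0∷ b≡0 []≈q) = sym (evalP-zero x (0∷≈[] b≡0 (≈ₚ-sym []≈q)))

    evalP-sqP : ∀ p x → evalP R (sqP p) x ≈ evalP R p (x * x)
    evalP-sqP [] x = refl
    evalP-sqP (a ∷ p) x = +-congˡ (begin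
      x * (0# + x * evalP R (sqP p) x)   ≈⟨ *-congˡ (trans (+-identityˡ _) (*-congˡ (evalP-sqP p x))) ⟩
      x * (x * evalP R p (x * x))        ≈⟨ *-assoc _ _ _ ⟨
      x * x * evalP R p (x * x)          ∎)

    evalP-shiftP : ∀ s p x → evalP R (shiftP s p) x ≈ powR R x s * evalP R p x
    evalP-shiftP zero p x = sym (*-identityˡ _)
    evalP-shiftP (suc s) p x = begin
      0# + x * evalP R (shiftP s p) x   ≈⟨ trans (+-identityˡ _) (*-congˡ (evalP-shiftP s p x)) ⟩
      x * (powR R x s * evalP R p x)    ≈⟨ *-assoc _ _ _ ⟨
      x * powR R x s * evalP R p x      ∎

    evalP-1 : ∀ x → evalP R [ + 1 ] x ≈ 1#
    evalP-1 x = trans (+-congˡ (zeroʳ _)) (trans (+-identityʳ _) natR-1)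

module ExactDivision where

  open Polynomials
  open import Data.Nat as ℕ using (zero; suc; _≤_; _<_; z≤n; s≤s; _<?_; _∸_)
  import Data.Nat.Properties as ℕₚ
  open import Data.Integer as ℤ using (+_; -[1+_])
  import Data.Integer.Properties as ℤₚ
  open import Data.List using ([]; _∷_; [_]; _++_; _∷ʳ_; length; reverse)
  open import Data.List.Properties using (unfold-reverse; reverse-involutive; length-reverse; length-++; length-map; map-++)
  open import Data.Product using (∃; ∃₂; _×_; _,_)
  open import Data.Sum using (_⊎_; inj₁; inj₂)
  open import Data.Empty using (⊥-elim)
  open import Relation.Nullary using (¬_; yes; no)
  open import Algebra.Bundles using (CommutativeRing)
  open import Relation.Binary.PropositionalEquality using (_≡_; _≢_; refl; sym; trans; cong; cong₂; subst; subst₂)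

  Normal : Poly → Set
  Normal p = p ≡ [] ⊎ ∃₂ λ xs c → c ≢ + 0 × p ≡ xs ∷ʳ c

  Monic : Poly → Set
  Monic p = ∃ λ gs → p ≈ₚ gs ∷ʳ + 1

  length-∷ʳ : ∀ (xs : Poly) c → length (xs ∷ʳ c) ≡ suc (length xs)
  length-∷ʳ xs c = trans (length-++ xs) (ℕₚ.+-comm (length xs) 1)

  ++-zeros : ∀ xs {zs} → zs ≈ₚ [] → xs ++ zs ≈ₚ xs
  ++-zeros [] zs≈[] = zs≈[]
  ++-zeros (x ∷ xs) zs≈[] = refl ∷ ++-zeros xs zs≈[]

  ++≈⊕shiftP : ∀ xs ys → xs ++ ys ≈ₚ xs ⊕ shiftP (length xs) ys
  ++≈⊕shiftP [] ys = ≈ₚ-refl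
  ++≈⊕shiftP (x ∷ xs) ys = sym (ℤₚ.+-identityʳ x) ∷ ++≈⊕shiftP xs ys

  reverse-dropZeros : ∀ r → reverse (dropZeros r) ≈ₚ reverse r
  reverse-dropZeros [] = []
  reverse-dropZeros (+ zero ∷ r) = ≈ₚ-trans (reverse-dropZeros r) (≈ₚ-sym
    (subst (_≈ₚ reverse r) (sym (unfold-reverse (+ 0) r)) (++-zeros (reverse r) (0∷≈[] refl []))))
  reverse-dropZeros (+ suc n ∷ r) = ≈ₚ-refl
  reverse-dropZeros (-[1+ n ] ∷ r) = ≈ₚ-refl

  reverse-dropZeros-normal : ∀ r → Normal (reverse (dropZeros r))
  reverse-dropZeros-normal [] = inj₁ refl
  reverse-dropZeros-normal (+ zero ∷ r) = reverse-dropZeros-normal r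
  reverse-dropZeros-normal (+ suc n ∷ r) = inj₂ (reverse r , + suc n , (λ ()) , unfold-reverse _ r)
  reverse-dropZeros-normal (-[1+ n ] ∷ r) = inj₂ (reverse r , -[1+ n ] , (λ ()) , unfold-reverse _ r)

  trim≈ₚ : ∀ p → trim p ≈ₚ p
  trim≈ₚ p = subst (trim p ≈ₚ_) (reverse-involutive p) (reverse-dropZeros (reverse p))

  trim-normal : ∀ p → Normal (trim p)
  trim-normal p = reverse-dropZeros-normal (reverse p)

  length-trim : ∀ p → length (trim p) ≤ length p
  length-trim p = subst₂ _≤_ (sym (length-reverse (dropZeros (reverse p)))) (length-reverse p)
    (length-dropZeros (reverse p))
    where
    length-dropZeros : ∀ r → length (dropZeros r) ≤ length r
    length-dropZeros [] = z≤n
    length-dropZeros (+ zero ∷ r) = ℕₚ.m≤n⇒m≤1+n (length-dropZeros r)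
    length-dropZeros (+ suc n ∷ r) = ℕₚ.≤-refl
    length-dropZeros (-[1+ n ] ∷ r) = ℕₚ.≤-refl

  ∷ʳ≈[]⇒≡0 : ∀ xs c → xs ∷ʳ c ≈ₚ [] → c ≡ + 0
  ∷ʳ≈[]⇒≡0 [] c (0∷≈[] c≡0 _) = c≡0
  ∷ʳ≈[]⇒≡0 (x ∷ xs) c (0∷≈[] _ xs∷ʳc≈[]) = ∷ʳ≈[]⇒≡0 xs c xs∷ʳc≈[]

  ∷ʳ-≈⇒≡ : ∀ xs c ys d → c ≢ + 0 → d ≢ + 0 → xs ∷ʳ c ≈ₚ ys ∷ʳ d → xs ∷ʳ c ≡ ys ∷ʳ d
  ∷ʳ-≈⇒≡ [] c [] d _ _ (c≡d ∷ _) = cong [_] c≡d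
  ∷ʳ-≈⇒≡ [] c (y ∷ ys) d _ d≢0 (_ ∷ []≈) = ⊥-elim (d≢0 (∷ʳ≈[]⇒≡0 ys d (≈ₚ-sym []≈)))
  ∷ʳ-≈⇒≡ (x ∷ xs) c [] d c≢0 _ (_ ∷ ≈[]) = ⊥-elim (c≢0 (∷ʳ≈[]⇒≡0 xs c ≈[]))
  ∷ʳ-≈⇒≡ (x ∷ xs) c (y ∷ ys) d c≢0 d≢0 (x≡y ∷ ≈) = cong₂ _∷_ x≡y (∷ʳ-≈⇒≡ xs c ys d c≢0 d≢0 ≈)

  normal-≈⇒≡ : ∀ {p q} → Normal p → Normal q → p ≈ₚ q → p ≡ q
  normal-≈⇒≡ (inj₁ refl) (inj₁ refl) _ = refl
  normal-≈⇒≡ (inj₁ refl) (inj₂ (ys , d , d≢0 , refl)) []≈ = ⊥-elim (d≢0 (∷ʳ≈[]⇒≡0 ys d (≈ₚ-sym []≈)))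
  normal-≈⇒≡ (inj₂ (xs , c , c≢0 , refl)) (inj₁ refl) ≈[] = ⊥-elim (c≢0 (∷ʳ≈[]⇒≡0 xs c ≈[]))
  normal-≈⇒≡ (inj₂ (xs , c , c≢0 , refl)) (inj₂ (ys , d , d≢0 , refl)) ≈ = ∷ʳ-≈⇒≡ xs c ys d c≢0 d≢0 ≈

  trim-cong : ∀ {p q} → p ≈ₚ q → trim p ≡ trim q
  trim-cong {p} {q} p≈q = normal-≈⇒≡ (trim-normal p) (trim-normal q)
    (≈ₚ-trans (trim≈ₚ p) (≈ₚ-trans p≈q (≈ₚ-sym (trim≈ₚ q))))

  trim-normal≡ : ∀ {p} → Normal p → trim p ≡ p
  trim-normal≡ {p} np = normal-≈⇒≡ (trim-normal p) np (trim≈ₚ p)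

  trim-monic : ∀ {p} → ((gs , _) : Monic p) → trim p ≡ gs ∷ʳ + 1
  trim-monic {p} (gs , p≈) = trans (trim-cong p≈) (trim-normal≡ (inj₂ (gs , + 1 , (λ ()) , refl)))

  lead-∷ʳ : ∀ xs c → lead (xs ∷ʳ c) ≡ c
  lead-∷ʳ [] c = refl
  lead-∷ʳ (x ∷ []) c = refl
  lead-∷ʳ (x ∷ y ∷ xs) c = lead-∷ʳ (y ∷ xs) c

  ⊕-∷ʳ : ∀ p xs c → length p ≤ length xs → p ⊕ (xs ∷ʳ c) ≡ (p ⊕ xs) ∷ʳ c
  ⊕-∷ʳ [] xs c _ = refl
  ⊕-∷ʳ (a ∷ p) (x ∷ xs) c (s≤s p≤xs) = cong (a ℤ.+ x ∷_) (⊕-∷ʳ p xs c p≤xs)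

  length-⊕ : ∀ p xs → length p ≤ length xs → length (p ⊕ xs) ≡ length xs
  length-⊕ [] xs _ = refl
  length-⊕ (a ∷ p) (x ∷ xs) (s≤s p≤xs) = cong suc (length-⊕ p xs p≤xs)

  ∷ʳ-⊗-monic : ∀ ms c gs → ∃ λ Q → length Q ≡ length ms ℕ.+ length gs × (ms ∷ʳ c) ⊗ (gs ∷ʳ + 1) ≈ₚ Q ∷ʳ c
  ∷ʳ-⊗-monic [] c gs = scale c gs , length-map _ gs ,
    ≈ₚ-trans (z≈[]⇒p⊕z≈p (scale c (gs ∷ʳ + 1)) (0∷≈[] refl []))
      (≡⇒≈ₚ (trans (map-++ (c ℤ.*_) gs [ + 1 ]) (cong (λ z → scale c gs ∷ʳ z) (ℤₚ.*-identityʳ c))))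
  ∷ʳ-⊗-monic (m ∷ ms) c gs with ∷ʳ-⊗-monic ms c gs
  ... | Q , |Q| , ≈Q∷ʳc = scale m g ⊕ (+ 0 ∷ Q) , trans (length-⊕ (scale m g) (+ 0 ∷ Q) m·g≤) (cong suc |Q|) ,
    ≈ₚ-trans (⊕-congˡ (scale m g) (refl ∷ ≈Q∷ʳc))
      (≡⇒≈ₚ (⊕-∷ʳ (scale m g) (+ 0 ∷ Q) c m·g≤))
    where
    g = gs ∷ʳ + 1
    m·g≤ : length (scale m g) ≤ length (+ 0 ∷ Q)
    m·g≤ = subst₂ _≤_ (sym (trans (length-map _ g) (length-∷ʳ gs (+ 1)))) (cong suc (sym |Q|))
             (s≤s (ℕₚ.m≤n+m (length gs) (length ms)))

  trim≡⇒≈ₚ : ∀ p {q} → trim p ≡ q → p ≈ₚ q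
  trim≡⇒≈ₚ p trim≡ = ≈ₚ-trans (≈ₚ-sym (trim≈ₚ p)) (≡⇒≈ₚ trim≡)

  trim-⊗-monic : ∀ {f} M ms c gs → c ≢ + 0 → trim M ≡ ms ∷ʳ c → f ≈ₚ M ⊗ (gs ∷ʳ + 1) →
                 ∃ λ Q → length Q ≡ length ms ℕ.+ length gs × trim f ≡ Q ∷ʳ c
  trim-⊗-monic M ms c gs c≢0 trimM≡ f≈ with ∷ʳ-⊗-monic ms c gs
  ... | Q , |Q| , ≈Q∷ʳc = Q , |Q| , trans (trim-cong f≈Q∷ʳc) (trim-normal≡ (inj₂ (Q , c , c≢0 , refl)))
    where
    f≈Q∷ʳc : _ ≈ₚ Q ∷ʳ c
    f≈Q∷ʳc = ≈ₚ-trans f≈ (≈ₚ-trans (⊗-congʳ _ (trim≡⇒≈ₚ M trimM≡)) ≈Q∷ʳc)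

  divFuel-[] : ∀ fuel f g → trim f ≡ [] → divFuel (suc fuel) f g ≡ []
  divFuel-[] fuel f g trim≡[] rewrite trim≡[] = refl

  divFuel-step : ∀ fuel f g xs c → trim f ≡ xs ∷ʳ c → ¬ length (xs ∷ʳ c) < length g →
    let t = shiftP (length (xs ∷ʳ c) ∸ length g) [ c ] in
    divFuel (suc fuel) f g ≡ t ⊕ divFuel fuel ((xs ∷ʳ c) ⊕ negP (t ⊗ g)) g
  divFuel-step fuel f g [] c trim≡ ≮ rewrite trim≡ with 1 <? length g
  ... | yes < = ⊥-elim (≮ <)
  ... | no _ = refl
  divFuel-step fuel f g (x ∷ xs) c trim≡ ≮ rewrite trim≡ with length (x ∷ xs ∷ʳ c) <? length g
  ... | yes < = ⊥-elim (≮ <)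
  ... | no _ rewrite lead-∷ʳ (x ∷ xs) c = refl

  open import Algebra.Properties.AbelianGroup (CommutativeRing.+-abelianGroup Poly-commutativeRing) using (xyx⁻¹≈y)
  open import Relation.Binary.Reasoning.Setoid ≈ₚ-setoid

  divFuel-step-monic : ∀ fuel f gs (ms Q : Poly) c → length Q ≡ length ms ℕ.+ length gs → trim f ≡ Q ∷ʳ c →
    let g = gs ∷ʳ + 1 ; t = shiftP (length ms) [ c ] in
    divFuel (suc fuel) f g ≡ t ⊕ divFuel fuel ((Q ∷ʳ c) ⊕ negP (t ⊗ g)) g
  divFuel-step-monic fuel f gs ms Q c |Q| trimf≡ =
    trans (divFuel-step fuel f g Q c trimf≡ L≮g)
          (cong (λ s → shiftP s [ c ] ⊕ divFuel fuel ((Q ∷ʳ c) ⊕ negP (shiftP s [ c ] ⊗ g)) g) |L|∸|g|)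
    where
    g = gs ∷ʳ + 1
    |L| : length (Q ∷ʳ c) ≡ suc (length ms ℕ.+ length gs)
    |L| = trans (length-∷ʳ Q c) (cong suc |Q|)
    |L|∸|g| : length (Q ∷ʳ c) ∸ length g ≡ length ms
    |L|∸|g| = trans (cong₂ _∸_ |L| (length-∷ʳ gs (+ 1))) (ℕₚ.m+n∸n≡m (length ms) (length gs))
    L≮g : ¬ length (Q ∷ʳ c) < length g
    L≮g L<g = ℕₚ.<⇒≱ L<g (subst₂ _≤_ (sym (length-∷ʳ gs (+ 1))) (sym |L|) (s≤s (ℕₚ.m≤n+m (length gs) (length ms))))

  cancel-leading-term : ∀ {L} ms c g → L ≈ₚ (ms ∷ʳ c) ⊗ g → L ⊕ negP (shiftP (length ms) [ c ] ⊗ g) ≈ₚ ms ⊗ g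
  cancel-leading-term {L} ms c g L≈ = begin
    L ⊕ negP (t ⊗ g)                       ≈⟨ ⊕-congʳ (negP (t ⊗ g)) (≈ₚ-trans L≈ (⊗-congʳ g ms∷ʳc≈t⊕ms)) ⟩
    (t ⊕ ms) ⊗ g ⊕ negP (t ⊗ g)            ≈⟨ ⊕-congʳ (negP (t ⊗ g)) (⊗-distribʳ-⊕ g t ms) ⟩
    (t ⊗ g ⊕ ms ⊗ g) ⊕ negP (t ⊗ g)        ≈⟨ xyx⁻¹≈y (t ⊗ g) (ms ⊗ g) ⟩
    ms ⊗ g                                 ∎
    where
    t = shiftP (length ms) [ c ]
    ms∷ʳc≈t⊕ms : ms ∷ʳ c ≈ₚ t ⊕ ms
    ms∷ʳc≈t⊕ms = ≈ₚ-trans (++≈⊕shiftP ms [ c ]) (⊕-comm ms t)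

  -- Each step of the long division removes the leading term of the quotient M.
  divFuel-exact : ∀ gs fuel M f → length M < fuel → f ≈ₚ M ⊗ (gs ∷ʳ + 1) → divFuel fuel f (gs ∷ʳ + 1) ≈ₚ M
  divFuel-exact gs (suc fuel) M f M<fuel f≈ with trim-normal M
  ... | inj₁ trimM≡[] = subst (_≈ₚ M) (sym (divFuel-[] fuel f g (trim-cong f≈[]))) (≈ₚ-sym M≈[])
    where
    g = gs ∷ʳ + 1
    M≈[] : M ≈ₚ []
    M≈[] = trim≡⇒≈ₚ M trimM≡[]
    f≈[] : f ≈ₚ []
    f≈[] = ≈ₚ-trans f≈ (z≈[]⇒z⊗q≈[] g M≈[])
  ... | inj₂ (ms , c , c≢0 , trimM≡) with trim-⊗-monic M ms c gs c≢0 trimM≡ f≈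
  ... | Q , |Q| , trimf≡ = begin
    divFuel (suc fuel) f g                  ≡⟨ divFuel-step-monic fuel f gs ms Q c |Q| trimf≡ ⟩
    t ⊕ divFuel fuel (L ⊕ negP (t ⊗ g)) g   ≈⟨ ⊕-congˡ t (divFuel-exact gs fuel ms (L ⊕ negP (t ⊗ g)) ms<fuel L-t·g≈ms·g) ⟩
    t ⊕ ms                                  ≈⟨ ⊕-comm t ms ⟩
    ms ⊕ t                                  ≈⟨ ++≈⊕shiftP ms [ c ] ⟨
    ms ∷ʳ c                                 ≈⟨ trim≡⇒≈ₚ M trimM≡ ⟨
    M                                       ∎
    where
    g = gs ∷ʳ + 1
    L = Q ∷ʳ c
    t = shiftP (length ms) [ c ]
    ms<fuel : length ms < fuel
    ms<fuel = ℕₚ.≤-trans (subst (_≤ length M) (trans (cong length trimM≡) (length-∷ʳ ms c)) (length-trim M)) (ℕₚ.≤-pred M<fuel)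
    L-t·g≈ms·g : L ⊕ negP (t ⊗ g) ≈ₚ ms ⊗ g
    L-t·g≈ms·g = cancel-leading-term ms c g
      (≈ₚ-trans (≈ₚ-sym (trim≡⇒≈ₚ f trimf≡)) (≈ₚ-trans f≈ (⊗-congʳ g (trim≡⇒≈ₚ M trimM≡))))

  length-trim-factor : ∀ f M gs → f ≈ₚ M ⊗ (gs ∷ʳ + 1) → length (trim M) ≤ length f
  length-trim-factor f M gs f≈ with trim-normal M
  ... | inj₁ trimM≡[] rewrite trimM≡[] = z≤n
  ... | inj₂ (ms , c , c≢0 , trimM≡) with trim-⊗-monic M ms c gs c≢0 trimM≡ f≈
  ... | Q , |Q| , trimf≡ = ℕₚ.≤-trans |trimM|≤|trimf| (length-trim f)
    where
    |trimM|≤|trimf| : length (trim M) ≤ length (trim f)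
    |trimM|≤|trimf| = subst₂ _≤_ (sym (trans (cong length trimM≡) (length-∷ʳ ms c)))
      (sym (trans (cong length trimf≡) (trans (length-∷ʳ Q c) (cong suc |Q|))))
      (s≤s (ℕₚ.m≤m+n (length ms) (length gs)))

  ÷-exact : ∀ {f g} M → Monic g → f ≈ₚ M ⊗ g → f ÷ g ≈ₚ M
  ÷-exact {f} {g} M (gs , g≈) f≈ rewrite trim-monic (gs , g≈) =
    ≈ₚ-trans (divFuel-exact gs (suc (length f)) (trim M) f (s≤s (length-trim-factor f M gs f≈′)) f≈trimM·g)
             (trim≈ₚ M)
    where
    f≈′ : f ≈ₚ M ⊗ (gs ∷ʳ + 1)
    f≈′ = ≈ₚ-trans f≈ (⊗-congˡ M g≈)
    f≈trimM·g : f ≈ₚ trim M ⊗ (gs ∷ʳ + 1)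
    f≈trimM·g = ≈ₚ-trans f≈′ (⊗-congʳ _ (≈ₚ-sym (trim≈ₚ M)))

module GaussianBinomials where

  open Polynomials
  open ExactDivision using (Monic; ∷ʳ-⊗-monic; ++≈⊕shiftP; ÷-exact)
  open import Data.Nat as ℕ using (ℕ; zero; suc)
  import Data.Nat.Properties as ℕₚ
  open import Data.Nat.ListAction using (sum)
  open import Data.Integer using (ℤ; +_)
  open import Data.List using (List; []; _∷_; [_]; replicate; _++_; foldr; length)
  open import Data.List.Properties using (length-replicate)
  open import Data.Product using (_,_)
  open import Algebra.Bundles using (CommutativeRing)
  import Algebra.Solver.Ring.NaturalCoefficients.Default as NaturalCoefficientsSolver
  open import Relation.Binary.PropositionalEquality as ≡ using (_≡_)
  open import Relation.Binary.Reasoning.Setoid ≈ₚ-setoid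

  open NaturalCoefficientsSolver (CommutativeRing.commutativeSemiring Poly-commutativeRing)
    using (solve; _:=_; _:+_; _:*_)

  -- qbinom K S is the Gaussian binomial coefficient [K + S choose K]_q.
  qbinom : ℕ → ℕ → Poly
  qbinom zero S = [ + 1 ]
  qbinom (suc K) zero = [ + 1 ]
  qbinom (suc K) (suc S) = qbinom K (suc S) ⊕ shiftP (suc K) (qbinom (suc K) S)

  qbinomProduct : List ℕ → Poly
  qbinomProduct [] = [ + 1 ]
  qbinomProduct (a ∷ as) = qbinom a (sum as) ⊗ qbinomProduct as

  qfactProduct : List ℕ → Poly
  qfactProduct = foldr (λ a acc → qfact a ⊗ acc) [ + 1 ]

  X^_ : ℕ → Poly
  X^ s = shiftP s [ + 1 ]

  shiftP≈X^⊗ : ∀ s p → shiftP s p ≈ₚ X^ s ⊗ p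
  shiftP≈X^⊗ zero p = ≈ₚ-sym (⊗-identityˡ p)
  shiftP≈X^⊗ (suc s) p = ≈ₚ-trans (≡.refl ∷ shiftP≈X^⊗ s p) (≈ₚ-sym (0∷-⊗ (X^ s) p))

  replicate-+ : ∀ a b (z : ℤ) → replicate (a ℕ.+ b) z ≡ replicate a z ++ replicate b z
  replicate-+ zero b z = ≡.refl
  replicate-+ (suc a) b z = ≡.cong (z ∷_) (replicate-+ a b z)

  qint-+ : ∀ a b → qint (a ℕ.+ b) ≈ₚ qint a ⊕ X^ a ⊗ qint b
  qint-+ a b = begin
    qint (a ℕ.+ b)                            ≡⟨ replicate-+ a b (+ 1) ⟩
    qint a ++ qint b                          ≈⟨ ++≈⊕shiftP (qint a) (qint b) ⟩
    qint a ⊕ shiftP (length (qint a)) (qint b) ≡⟨ ≡.cong (λ k → qint a ⊕ shiftP k (qint b)) (length-replicate a) ⟩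
    qint a ⊕ shiftP a (qint b)                ≈⟨ ⊕-congˡ (qint a) (shiftP≈X^⊗ a (qint b)) ⟩
    qint a ⊕ X^ a ⊗ qint b                    ∎

  qbinom-qfact : ∀ K S → qbinom K S ⊗ (qfact K ⊗ qfact S) ≈ₚ qfact (K ℕ.+ S)
  qbinom-qfact zero S = ≈ₚ-trans (⊗-identityˡ _) (⊗-identityˡ _)
  qbinom-qfact (suc K) zero = ≈ₚ-trans (⊗-identityˡ _)
    (≈ₚ-trans (⊗-identityʳ _) (≡⇒≈ₚ (≡.cong qfact (≡.sym (ℕₚ.+-identityʳ (suc K))))))
  qbinom-qfact (suc K) (suc S) = begin
    (A ⊕ shiftP (suc K) B) ⊗ ((iK ⊗ FK) ⊗ (iS ⊗ FS))
      ≈⟨ ⊗-congʳ _ (⊕-congˡ A (shiftP≈X^⊗ (suc K) B)) ⟩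
    (A ⊕ XK ⊗ B) ⊗ ((iK ⊗ FK) ⊗ (iS ⊗ FS))
      ≈⟨ solve 7 (λ A B XK iK FK iS FS →
           (A :+ XK :* B) :* ((iK :* FK) :* (iS :* FS)) :=
           iK :* (A :* (FK :* (iS :* FS))) :+ (XK :* iS) :* (B :* ((iK :* FK) :* FS)))
           ≈ₚ-refl A B XK iK FK iS FS ⟩
    iK ⊗ (A ⊗ (FK ⊗ (iS ⊗ FS))) ⊕ (XK ⊗ iS) ⊗ (B ⊗ ((iK ⊗ FK) ⊗ FS))
      ≈⟨ ⊕-cong (⊗-congˡ iK (qbinom-qfact K (suc S))) (⊗-congˡ (XK ⊗ iS) (qbinom-qfact (suc K) S)) ⟩
    iK ⊗ qfact (K ℕ.+ suc S) ⊕ (XK ⊗ iS) ⊗ qfact (suc K ℕ.+ S)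
      ≡⟨ ≡.cong (λ k → iK ⊗ qfact (K ℕ.+ suc S) ⊕ (XK ⊗ iS) ⊗ qfact k) (≡.sym (ℕₚ.+-suc K S)) ⟩
    iK ⊗ F ⊕ (XK ⊗ iS) ⊗ F
      ≈⟨ ⊗-distribʳ-⊕ F iK (XK ⊗ iS) ⟨
    (iK ⊕ XK ⊗ iS) ⊗ F
      ≈⟨ ⊗-congʳ F (qint-+ (suc K) (suc S)) ⟨
    qint (suc K ℕ.+ suc S) ⊗ F
      ∎
    where
    A = qbinom K (suc S)
    B = qbinom (suc K) S
    XK = X^ suc K
    iK = qint (suc K)
    iS = qint (suc S)
    FK = qfact K
    FS = qfact S
    F = qfact (K ℕ.+ suc S)

  qbinomProduct-qfactProduct : ∀ as → qbinomProduct as ⊗ qfactProduct as ≈ₚ qfact (sum as)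
  qbinomProduct-qfactProduct [] = ⊗-identityˡ [ + 1 ]
  qbinomProduct-qfactProduct (a ∷ as) = begin
    (qbinom a s ⊗ qbinomProduct as) ⊗ (qfact a ⊗ qfactProduct as)
      ≈⟨ solve 4 (λ B M F D → (B :* M) :* (F :* D) := B :* (F :* (M :* D)))
                 ≈ₚ-refl (qbinom a s) (qbinomProduct as) (qfact a) (qfactProduct as) ⟩
    qbinom a s ⊗ (qfact a ⊗ (qbinomProduct as ⊗ qfactProduct as))
      ≈⟨ ⊗-congˡ (qbinom a s) (⊗-congˡ (qfact a) (qbinomProduct-qfactProduct as)) ⟩
    qbinom a s ⊗ (qfact a ⊗ qfact s)
      ≈⟨ qbinom-qfact a s ⟩
    qfact (a ℕ.+ s)
      ∎
    where s = sum as

  monic-⊗ : ∀ {p q} → Monic p → Monic q → Monic (p ⊗ q)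
  monic-⊗ (ps , p≈) (qs , q≈) with ∷ʳ-⊗-monic ps (+ 1) qs
  ... | Q , _ , ≈Q∷ʳ1 = Q , ≈ₚ-trans (⊗-cong p≈ q≈) ≈Q∷ʳ1

  monic-qint : ∀ a → Monic (qint (suc a))
  monic-qint a = qint a , ≡⇒≈ₚ (≡.trans (≡.cong qint (ℕₚ.+-comm 1 a)) (replicate-+ a 1 (+ 1)))

  monic-qfact : ∀ a → Monic (qfact a)
  monic-qfact zero = [] , ≈ₚ-refl
  monic-qfact (suc a) = monic-⊗ (monic-qint a) (monic-qfact a)

  monic-qfactProduct : ∀ as → Monic (qfactProduct as)
  monic-qfactProduct [] = [] , ≈ₚ-refl
  monic-qfactProduct (a ∷ as) = monic-⊗ (monic-qfact a) (monic-qfactProduct as)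

  qmultinom≈qbinomProduct : ∀ as → qmultinom as ≈ₚ qbinomProduct as
  qmultinom≈qbinomProduct as =
    ÷-exact (qbinomProduct as) (monic-qfactProduct as) (≈ₚ-sym (qbinomProduct-qfactProduct as))

  qint[2a]÷qint[a] : ∀ a → qint (2 ℕ.* suc a) ÷ qint (suc a) ≈ₚ [ + 1 ] ⊕ X^ suc a
  qint[2a]÷qint[a] a = ÷-exact ([ + 1 ] ⊕ X^ suc a) (monic-qint a) (begin
    qint (suc a ℕ.+ (suc a ℕ.+ 0))          ≡⟨ ≡.cong (λ k → qint (suc a ℕ.+ k)) (ℕₚ.+-identityʳ (suc a)) ⟩
    qint (suc a ℕ.+ suc a)                  ≈⟨ qint-+ (suc a) (suc a) ⟩
    qint (suc a) ⊕ X^ suc a ⊗ qint (suc a)  ≈⟨ ⊕-congʳ (X^ suc a ⊗ qint (suc a)) (⊗-identityˡ (qint (suc a))) ⟨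
    [ + 1 ] ⊗ qint (suc a) ⊕ X^ suc a ⊗ qint (suc a)  ≈⟨ ⊗-distribʳ-⊕ (qint (suc a)) [ + 1 ] (X^ suc a) ⟨
    ([ + 1 ] ⊕ X^ suc a) ⊗ qint (suc a)     ∎)

module Binomials where

  open import Data.Nat using (ℕ; suc; _+_; _*_; _∸_; _!; _≤_; _/_)
  open import Data.Nat.Properties using (m≤m+n; m+n∸m≡n; +-suc; _!≢0; m*n≢0; +-identityʳ)
  open import Data.Nat.DivMod using (m/n*n≡m; m*n/n≡m)
  open import Data.Nat.Combinatorics using (_C_; nCk≡n!/k![n-k]!; k![n∸k]!∣n!; nCk+nC[k+1]≡[n+1]C[k+1]; nCn≡1)
  open import Data.Nat.ListAction using (sum)
  open import Data.List using (List; []; _∷_; [_]; _++_; map)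
  open import Data.List.Relation.Unary.All using (All; []; _∷_)
  open import Data.Nat.Divisibility using (_∣_; divides)
  open import Data.Nat.Solver using (module +-*-Solver)
  open import Relation.Binary.PropositionalEquality using (_≡_; refl; sym; trans; cong; subst)
  open Relation.Binary.PropositionalEquality.≡-Reasoning

  binomProduct : List ℕ → ℕ
  binomProduct [] = 1
  binomProduct (a ∷ as) = ((a + sum as) C a) * binomProduct as

  nCk*[k!*[n∸k]!]≡n! : ∀ {n k} → k ≤ n → (n C k) * (k ! * (n ∸ k) !) ≡ n !
  nCk*[k!*[n∸k]!]≡n! {n} {k} k≤n = trans (cong (_* (k ! * (n ∸ k) !)) (nCk≡n!/k![n-k]! k≤n)) (m/n*n≡m (k![n∸k]!∣n! k≤n))
    where instance _ = m*n≢0 (k !) ((n ∸ k) !) {{k !≢0}} {{(n ∸ k) !≢0}}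

  [a+s]Ca*[a!*s!]≡[a+s]! : ∀ a s → ((a + s) C a) * (a ! * s !) ≡ (a + s) !
  [a+s]Ca*[a!*s!]≡[a+s]! a s = subst (λ t → ((a + s) C a) * (a ! * t !) ≡ (a + s) !) (m+n∸m≡n a s) (nCk*[k!*[n∸k]!]≡n! (m≤m+n a s))

  binomProduct-factProd : ∀ as → binomProduct as * factProd as ≡ sum as !
  binomProduct-factProd [] = refl
  binomProduct-factProd (a ∷ as) = begin
    (b * binomProduct as) * (a ! * factProd as)  ≡⟨ rearrange b (binomProduct as) (a !) (factProd as) ⟩
    b * (a ! * (binomProduct as * factProd as))  ≡⟨ cong (λ x → b * (a ! * x)) (binomProduct-factProd as) ⟩
    b * (a ! * sum as !)                         ≡⟨ [a+s]Ca*[a!*s!]≡[a+s]! a (sum as) ⟩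
    (a + sum as) !                               ∎
    where
    b = (a + sum as) C a
    open +-*-Solver
    rearrange : ∀ b m f p → (b * m) * (f * p) ≡ b * (f * (m * p))
    rearrange = solve 4 (λ b m f p → (b :* m) :* (f :* p) := b :* (f :* (m :* p))) refl

  multinom≡binomProduct : ∀ as → multinom as ≡ binomProduct as
  multinom≡binomProduct as = trans (cong (λ x → (x / factProd as) {{factProd-nz as}}) (sym (binomProduct-factProd as)))
                                   (m*n/n≡m (binomProduct as) (factProd as) {{factProd-nz as}})

  C-pascal : ∀ c a → (suc c + suc a) C suc c ≡ (c + suc a) C c + (suc c + a) C suc c
  C-pascal c a = sym (trans (cong (λ n → (c + suc a) C c + n C suc c) (sym (+-suc c a))) (nCk+nC[k+1]≡[n+1]C[k+1] (c + suc a) c))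

  [c+0]Cc≡1 : ∀ c → (c + 0) C c ≡ 1
  [c+0]Cc≡1 c = trans (cong (_C c) (+-identityʳ c)) (nCn≡1 c)

  sum-digits : ∀ e-1 t bs → All (suc e-1 ∣_) bs →
               sum (bs ++ [ e-1 + t * suc e-1 ]) ≡ e-1 + sum (map (_/ suc e-1) bs ++ [ t ]) * suc e-1
  sum-digits e-1 t [] [] = solve 3 (λ e-1 t e → (e-1 :+ t :* e) :+ con 0 := e-1 :+ (t :+ con 0) :* e) refl e-1 t (suc e-1)
    where open +-*-Solver
  sum-digits e-1 t (_ ∷ bs) (divides q refl ∷ e∣bs) = begin
    q * e + sum (bs ++ [ e-1 + t * e ])   ≡⟨ cong (q * e +_) (sum-digits e-1 t bs e∣bs) ⟩
    q * e + (e-1 + A * e)                 ≡⟨ solve 4 (λ q e A e-1 → q :* e :+ (e-1 :+ A :* e) := e-1 :+ (q :+ A) :* e) refl q e A e-1 ⟩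
    e-1 + (q + A) * e                     ≡⟨ cong (λ x → e-1 + (x + A) * e) (m*n/n≡m q e) ⟨
    e-1 + (q * e / e + A) * e             ∎
    where
    open +-*-Solver
    e = suc e-1
    A = sum (map (_/ e) bs ++ [ t ])

module RootsOfUnity where

  open Evaluation
  open GaussianBinomials using (qbinom; qbinom-qfact; qbinomProduct)
  open Binomials using (binomProduct; C-pascal; [c+0]Cc≡1; sum-digits)
  open import Level using (Level)
  open import Data.Nat as ℕ using (ℕ; zero; suc; _≤_; _<_; z≤n; s≤s; _%_; _/_)
  open import Data.Nat.DivMod using (m%n<n; m≡m%n+[m/n]*n; m*n/n≡m)
  open import Data.Nat.ListAction using (sum)
  import Data.Nat.Properties as ℕₚ
  open import Data.Nat.Combinatorics using (_C_)
  open import Data.Nat.Divisibility using (_∣_; _∣?_; divides; m%n≡0⇒n∣m)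
  open import Data.Integer using (+_)
  open import Data.List using ([]; _∷_; [_]; _++_; map)
  open import Data.List.Relation.Unary.All using (All; []; _∷_; all?)
  open import Data.Product using (proj₁; proj₂)
  open import Data.Sum using (_⊎_; inj₁; inj₂)
  open import Data.Empty using (⊥-elim)
  open import Relation.Nullary using (¬_; yes; no)
  open import Algebra.Bundles using (CommutativeRing)
  import Algebra.Properties.Ring as RingProperties
  import Algebra.Solver.Ring.NaturalCoefficients.Default as NaturalCoefficientsSolver
  open import Relation.Binary.PropositionalEquality as ≡ using (_≡_)

  module _ {c ℓ : Level} (R : CommutativeRing c ℓ) where

    open CommutativeRing R
    open RingProperties ring using (x∙y⁻¹≈ε⇒x≈y; -‿distribʳ-*)
    open import Relation.Binary.Reasoning.Setoid setoid
    open NaturalCoefficientsSolver commutativeSemiring using (solve; _:=_; _:+_; _:*_; con)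

    private
      _^_ : Carrier → ℕ → Carrier
      _^_ = powR R

    ^-+ : ∀ x m n → x ^ (m ℕ.+ n) ≈ x ^ m * x ^ n
    ^-+ x zero n = sym (*-identityˡ _)
    ^-+ x (suc m) n = trans (*-congˡ (^-+ x m n)) (sym (*-assoc _ _ _))

    ^-*-distrib : ∀ x y n → (x * y) ^ n ≈ x ^ n * y ^ n
    ^-*-distrib x y zero = sym (*-identityˡ _)
    ^-*-distrib x y (suc n) = trans (*-congˡ (^-*-distrib x y n))
      (solve 4 (λ x y a b → (x :* y) :* (a :* b) := (x :* a) :* (y :* b)) refl x y (x ^ n) (y ^ n))

    square-^ : ∀ x n → (x * x) ^ n ≈ x ^ (2 ℕ.* n)
    square-^ x n = trans (^-*-distrib x x n)
      (trans (sym (^-+ x n n)) (reflexive (≡.cong (λ k → x ^ (n ℕ.+ k)) (≡.sym (ℕₚ.+-identityʳ n)))))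

    qint-geometric : ∀ x a → evalP R (qint a) x * (x - 1#) ≈ x ^ a - 1#
    qint-geometric x zero = trans (zeroˡ _) (sym (-‿inverseʳ 1#))
    qint-geometric x (suc a) = begin
      (natR R 1 + x * [a]) * (x - 1#)        ≈⟨ *-congʳ (+-congʳ (natR-1 R)) ⟩
      (1# + x * [a]) * (x + - 1#)            ≈⟨ solve 3 (λ x q m → (con 1 :+ x :* q) :* (x :+ m) := (x :+ m) :+ x :* (q :* (x :+ m)))
                                                         refl x [a] (- 1#) ⟩
      (x + - 1#) + x * ([a] * (x + - 1#))    ≈⟨ +-congˡ (*-congˡ (qint-geometric x a)) ⟩
      (x + - 1#) + x * (x ^ a + - 1#)        ≈⟨ solve 3 (λ x m P → (x :+ m) :+ x :* (P :+ m) := (x :* P :+ m) :+ (x :+ x :* m))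
                                                         refl x (- 1#) (x ^ a) ⟩
      (x * x ^ a + - 1#) + (x + x * - 1#)    ≈⟨ +-congˡ (trans (+-congˡ (trans (sym (-‿distribʳ-* x 1#)) (-‿cong (*-identityʳ x))))
                                                               (-‿inverseʳ x)) ⟩
      (x * x ^ a + - 1#) + 0#                ≈⟨ +-identityʳ _ ⟩
      x ^ suc a - 1#                         ∎
      where
      [a] = evalP R (qint a) x

    qbinom-pascal-at : ∀ x K S → evalP R (qbinom (suc K) (suc S)) x ≈
                       evalP R (qbinom K (suc S)) x + x ^ suc K * evalP R (qbinom (suc K) S) x
    qbinom-pascal-at x K S = trans (evalP-⊕ R (qbinom K (suc S)) _ x) (+-congˡ (evalP-shiftP R (suc K) (qbinom (suc K) S) x))

    qbinom-zeroˡ-at : ∀ x S → evalP R (qbinom 0 S) x ≈ 1#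
    qbinom-zeroˡ-at x S = evalP-1 R x

    qbinom-zeroʳ-at : ∀ x K → evalP R (qbinom K 0) x ≈ 1#
    qbinom-zeroʳ-at x zero = evalP-1 R x
    qbinom-zeroʳ-at x (suc K) = evalP-1 R x

    qbinom-qfact-at : ∀ x K S →
      evalP R (qbinom K S) x * (evalP R (qfact K) x * evalP R (qfact S) x) ≈ evalP R (qfact (K ℕ.+ S)) x
    qbinom-qfact-at x K S = begin
      evalP R (qbinom K S) x * (evalP R (qfact K) x * evalP R (qfact S) x)  ≈⟨ *-congˡ (evalP-⊗ R (qfact K) (qfact S) x) ⟨
      evalP R (qbinom K S) x * evalP R (qfact K ⊗ qfact S) x           ≈⟨ evalP-⊗ R (qbinom K S) _ x ⟨
      evalP R (qbinom K S ⊗ (qfact K ⊗ qfact S)) x                ≈⟨ evalP-cong R x (qbinom-qfact K S) ⟩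
      evalP R (qfact (K ℕ.+ S)) x                                           ∎

    -- The order is written suc e-1 so that the base-e expansions k₀ + k₁ * e below reduce by pattern matching.
    module _ (e-1 : ℕ) {ω : Carrier} (root : PrimitiveRoot R (suc e-1) ω) where

      private
        e : ℕ
        e = suc e-1

        ω^e≈1 : ω ^ e ≈ 1#
        ω^e≈1 = proj₁ root

        ω^j≉1 : ∀ j → 0 < j → j < e → ¬ ω ^ j ≈ 1#
        ω^j≉1 = proj₂ root

      ^-multiple : ∀ C → ω ^ (C ℕ.* e) ≈ 1#
      ^-multiple zero = refl
      ^-multiple (suc C) = trans (^-+ ω e (C ℕ.* e)) (trans (*-cong ω^e≈1 (^-multiple C)) (*-identityˡ 1#))

      ^-period : ∀ D C → ω ^ (D ℕ.+ C ℕ.* e) ≈ ω ^ D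
      ^-period D C = trans (^-+ ω D (C ℕ.* e)) (trans (*-congˡ (^-multiple C)) (*-identityʳ _))

      ∣⇒^≈1 : ∀ {j} → e ∣ j → ω ^ j ≈ 1#
      ∣⇒^≈1 (divides C ≡.refl) = ^-multiple C

      ^≈1⇒∣ : ∀ j → ω ^ j ≈ 1# → e ∣ j
      ^≈1⇒∣ j ω^j≈1 with j % e in j%e≡r | m%n<n j e
      ... | zero | _ = m%n≡0⇒n∣m j e j%e≡r
      ... | suc r | r<e = ⊥-elim (ω^j≉1 (suc r) (s≤s z≤n) r<e (begin
        ω ^ suc r                    ≡⟨ ≡.cong (ω ^_) j%e≡r ⟨
        ω ^ (j % e)                  ≈⟨ ^-period (j % e) (j / e) ⟨
        ω ^ (j % e ℕ.+ j / e ℕ.* e)  ≡⟨ ≡.cong (ω ^_) (m≡m%n+[m/n]*n j e) ⟨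
        ω ^ j                        ≈⟨ ω^j≈1 ⟩
        1#                           ∎))

      module _ (no-zero-divisors : ∀ a b → a * b ≈ 0# → a ≈ 0# ⊎ b ≈ 0#) (1≉0 : ¬ 1# ≈ 0#) where

        qint-nonzero : ∀ i → 0 < i → i < e → ¬ evalP R (qint i) ω ≈ 0#
        qint-nonzero i 0<i i<e [i]≈0 = ω^j≉1 i 0<i i<e (x∙y⁻¹≈ε⇒x≈y (ω ^ i) 1# (begin
          ω ^ i - 1#                          ≈⟨ qint-geometric ω i ⟨
          evalP R (qint i) ω * (ω - 1#)       ≈⟨ *-congʳ [i]≈0 ⟩
          0# * (ω - 1#)                       ≈⟨ zeroˡ _ ⟩
          0#                                  ∎))

        qfact-nonzero : ∀ i → i < e → ¬ evalP R (qfact i) ω ≈ 0#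
        qfact-nonzero zero _ [0]!≈0 = 1≉0 (trans (sym (evalP-1 R ω)) [0]!≈0)
        qfact-nonzero (suc i) i<e [i+1]!≈0
          with no-zero-divisors _ _ (trans (sym (evalP-⊗ R (qint (suc i)) (qfact i) ω)) [i+1]!≈0)
        ... | inj₁ [i+1]≈0 = qint-nonzero (suc i) (s≤s z≤n) i<e [i+1]≈0
        ... | inj₂ [i]!≈0 = qfact-nonzero i (ℕₚ.<-trans (ℕₚ.n<1+n i) i<e) [i]!≈0

        qint-vanish : 1 < e → evalP R (qint e) ω ≈ 0#
        qint-vanish 1<e with no-zero-divisors _ _ (trans (qint-geometric ω e) (trans (+-congʳ ω^e≈1) (-‿inverseʳ 1#)))
        ... | inj₁ [e]≈0 = [e]≈0
        ... | inj₂ ω-1≈0 = ⊥-elim (ω^j≉1 1 (s≤s z≤n) 1<e (trans (*-identityʳ ω) (x∙y⁻¹≈ε⇒x≈y ω 1# ω-1≈0)))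

        qfact-vanish : 1 < e → ∀ n → e ≤ n → evalP R (qfact n) ω ≈ 0#
        qfact-vanish 1<e (suc n) e≤n+1 = trans (evalP-⊗ R (qint (suc n)) (qfact n) ω) (vanishing-factor (ℕₚ.m≤n⇒m<n∨m≡n e≤n+1))
          where
          vanishing-factor : e < suc n ⊎ e ≡ suc n → evalP R (qint (suc n)) ω * evalP R (qfact n) ω ≈ 0#
          vanishing-factor (inj₁ e<n+1) = trans (*-congˡ (qfact-vanish 1<e n (ℕₚ.≤-pred e<n+1))) (zeroʳ _)
          vanishing-factor (inj₂ ≡.refl) = trans (*-congʳ (qint-vanish 1<e)) (zeroˡ _)

        -- [D + B]!_ω contains the factor [e]_ω = 0, while [D]!_ω [B]!_ω ≠ 0.
        qbinom-vanish : ∀ D B → D < e → B < e → e ≤ D ℕ.+ B → evalP R (qbinom D B) ω ≈ 0#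
        qbinom-vanish D B D<e B<e e≤D+B
          with no-zero-divisors _ _ (trans (qbinom-qfact-at ω D B) (qfact-vanish 1<e (D ℕ.+ B) e≤D+B))
          where
          0<B : 0 < B
          0<B = ℕₚ.+-cancelˡ-< D 0 B (ℕₚ.<-≤-trans (≡.subst (_< e) (≡.sym (ℕₚ.+-identityʳ D)) D<e) e≤D+B)
          1<e : 1 < e
          1<e = ℕₚ.≤-<-trans 0<B B<e
        ... | inj₁ qbinom≈0 = qbinom≈0
        ... | inj₂ [D]![B]!≈0 with no-zero-divisors _ _ [D]![B]!≈0
        ...   | inj₁ [D]!≈0 = ⊥-elim (qfact-nonzero D D<e [D]!≈0)
        ...   | inj₂ [B]!≈0 = ⊥-elim (qfact-nonzero B B<e [B]!≈0)

        private
          qbω : ℕ → ℕ → Carrier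
          qbω K S = evalP R (qbinom K S) ω

        qbinom-vanish-lastˡ : ∀ B → 0 < B → B < e → qbω e-1 B ≈ 0#
        qbinom-vanish-lastˡ B 0<B B<e = qbinom-vanish e-1 B (ℕₚ.n<1+n e-1) B<e
          (≡.subst (_≤ e-1 ℕ.+ B) (ℕₚ.+-comm e-1 1) (ℕₚ.+-monoʳ-≤ e-1 0<B))

        qbinom-vanish-lastʳ : ∀ D → 0 < D → D < e → qbω D e-1 ≈ 0#
        qbinom-vanish-lastʳ D 0<D D<e = qbinom-vanish D e-1 D<e (ℕₚ.n<1+n e-1) (ℕₚ.+-monoˡ-≤ e-1 0<D)

        lucasValue : ℕ → ℕ → ℕ → ℕ → Carrier
        lucasValue k₁ k₀ s₁ s₀ = natR R ((k₁ ℕ.+ s₁) C k₁) * qbω k₀ s₀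

        lucasValue-pascal : ∀ k₁ k₀ s₁ s₀ → lucasValue k₁ (suc k₀) s₁ (suc s₀) ≈
                            lucasValue k₁ k₀ s₁ (suc s₀) + ω ^ suc k₀ * lucasValue k₁ (suc k₀) s₁ s₀
        lucasValue-pascal k₁ k₀ s₁ s₀ = begin
          n * qbω (suc k₀) (suc s₀)                                 ≈⟨ *-congˡ (qbinom-pascal-at ω k₀ s₀) ⟩
          n * (qbω k₀ (suc s₀) + ω ^ suc k₀ * qbω (suc k₀) s₀)      ≈⟨ solve 4 (λ n a w b → n :* (a :+ w :* b) := n :* a :+ w :* (n :* b))
                                                                               refl n (qbω k₀ (suc s₀)) (ω ^ suc k₀) (qbω (suc k₀) s₀) ⟩
          n * qbω k₀ (suc s₀) + ω ^ suc k₀ * (n * qbω (suc k₀) s₀)  ∎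
          where n = natR R ((k₁ ℕ.+ s₁) C k₁)

        lucasValue-pascal-carryᴷ : ∀ k₁ s₁ s₀ → suc s₀ < e → lucasValue (suc k₁) 0 s₁ (suc s₀) ≈
                                   lucasValue k₁ e-1 s₁ (suc s₀) + 1# * lucasValue (suc k₁) 0 s₁ s₀
        lucasValue-pascal-carryᴷ k₁ s₁ s₀ s₀<e = sym (begin
          natR R ((k₁ ℕ.+ s₁) C k₁) * qbω e-1 (suc s₀) + 1# * (n * qbω 0 s₀)
            ≈⟨ +-cong (trans (*-congˡ (qbinom-vanish-lastˡ (suc s₀) (s≤s z≤n) s₀<e)) (zeroʳ _)) (*-identityˡ _) ⟩
          0# + n * qbω 0 s₀
            ≈⟨ trans (+-identityˡ _) (*-congˡ (trans (qbinom-zeroˡ-at ω s₀) (sym (qbinom-zeroˡ-at ω (suc s₀))))) ⟩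
          n * qbω 0 (suc s₀)
            ∎)
          where n = natR R ((suc k₁ ℕ.+ s₁) C suc k₁)

        lucasValue-pascal-carryˢ : ∀ k₁ k₀ s₁ → suc k₀ < e → lucasValue k₁ (suc k₀) (suc s₁) 0 ≈
                                   lucasValue k₁ k₀ (suc s₁) 0 + ω ^ suc k₀ * lucasValue k₁ (suc k₀) s₁ e-1
        lucasValue-pascal-carryˢ k₁ k₀ s₁ k₀<e = sym (begin
          n * qbω k₀ 0 + ω ^ suc k₀ * (natR R ((k₁ ℕ.+ s₁) C k₁) * qbω (suc k₀) e-1)
            ≈⟨ +-congˡ (trans (*-congˡ (trans (*-congˡ (qbinom-vanish-lastʳ (suc k₀) (s≤s z≤n) k₀<e)) (zeroʳ _))) (zeroʳ _)) ⟩
          n * qbω k₀ 0 + 0#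
            ≈⟨ trans (+-identityʳ _) (*-congˡ (trans (qbinom-zeroʳ-at ω k₀) (sym (qbinom-zeroʳ-at ω (suc k₀))))) ⟩
          n * qbω (suc k₀) 0
            ∎)
          where n = natR R ((k₁ ℕ.+ suc s₁) C k₁)

        lucasValue-pascal-carry² : ∀ k₁ s₁ → lucasValue (suc k₁) 0 (suc s₁) 0 ≈
                                   lucasValue k₁ e-1 (suc s₁) 0 + 1# * lucasValue (suc k₁) 0 s₁ e-1
        lucasValue-pascal-carry² k₁ s₁ = sym (begin
          natR R a * qbω e-1 0 + 1# * (natR R b * qbω 0 e-1)
            ≈⟨ +-cong (trans (*-congˡ (qbinom-zeroʳ-at ω e-1)) (*-identityʳ _))
                      (trans (*-identityˡ _) (trans (*-congˡ (qbinom-zeroˡ-at ω e-1)) (*-identityʳ _))) ⟩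
          natR R a + natR R b
            ≈⟨ natR-+ R a b ⟨
          natR R (a ℕ.+ b)
            ≡⟨ ≡.cong (natR R) (C-pascal k₁ s₁) ⟨
          natR R ((suc k₁ ℕ.+ suc s₁) C suc k₁)
            ≈⟨ trans (*-congˡ (qbinom-zeroˡ-at ω 0)) (*-identityʳ _) ⟨
          natR R ((suc k₁ ℕ.+ suc s₁) C suc k₁) * qbω 0 0
            ∎)
          where
          a = (k₁ ℕ.+ suc s₁) C k₁
          b = (suc k₁ ℕ.+ s₁) C suc k₁

        qbinom-pascal-≈ : ∀ K S {x w y} → qbω K (suc S) ≈ x → ω ^ suc K ≈ w → qbω (suc K) S ≈ y →
                          qbω (suc K) (suc S) ≈ x + w * y
        qbinom-pascal-≈ K S ≈x ≈w ≈y = trans (qbinom-pascal-at ω K S) (+-cong ≈x (*-cong ≈w ≈y))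

        qLucas : ∀ k₁ k₀ s₁ s₀ → k₀ < e → s₀ < e →
                 qbω (k₀ ℕ.+ k₁ ℕ.* e) (s₀ ℕ.+ s₁ ℕ.* e) ≈ lucasValue k₁ k₀ s₁ s₀
        qLucas zero zero s₁ s₀ _ _ = trans (qbinom-zeroˡ-at ω (s₀ ℕ.+ s₁ ℕ.* e))
          (sym (trans (*-cong (natR-1 R) (qbinom-zeroˡ-at ω s₀)) (*-identityˡ 1#)))
        qLucas k₁ k₀ zero zero _ _ = trans (qbinom-zeroʳ-at ω (k₀ ℕ.+ k₁ ℕ.* e))
          (sym (trans (*-cong (trans (reflexive (≡.cong (natR R) ([c+0]Cc≡1 k₁))) (natR-1 R)) (qbinom-zeroʳ-at ω k₀))
                      (*-identityˡ 1#)))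
        qLucas k₁ (suc k₀) s₁ (suc s₀) k₀<e s₀<e = trans
          (qbinom-pascal-≈ (k₀ ℕ.+ k₁ ℕ.* e) (s₀ ℕ.+ s₁ ℕ.* e)
            (qLucas k₁ k₀ s₁ (suc s₀) (ℕₚ.<⇒≤ k₀<e) s₀<e)
            (^-period (suc k₀) k₁)
            (qLucas k₁ (suc k₀) s₁ s₀ k₀<e (ℕₚ.<⇒≤ s₀<e)))
          (sym (lucasValue-pascal k₁ k₀ s₁ s₀))
        qLucas (suc k₁) zero s₁ (suc s₀) _ s₀<e = trans
          (qbinom-pascal-≈ (e-1 ℕ.+ k₁ ℕ.* e) (s₀ ℕ.+ s₁ ℕ.* e)
            (qLucas k₁ e-1 s₁ (suc s₀) (ℕₚ.n<1+n e-1) s₀<e)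
            (^-period 0 (suc k₁))
            (qLucas (suc k₁) 0 s₁ s₀ (s≤s z≤n) (ℕₚ.<⇒≤ s₀<e)))
          (sym (lucasValue-pascal-carryᴷ k₁ s₁ s₀ s₀<e))
        qLucas k₁ (suc k₀) (suc s₁) zero k₀<e _ = trans
          (qbinom-pascal-≈ (k₀ ℕ.+ k₁ ℕ.* e) (e-1 ℕ.+ s₁ ℕ.* e)
            (qLucas k₁ k₀ (suc s₁) 0 (ℕₚ.<⇒≤ k₀<e) (s≤s z≤n))
            (^-period (suc k₀) k₁)
            (qLucas k₁ (suc k₀) s₁ e-1 k₀<e (ℕₚ.n<1+n e-1)))
          (sym (lucasValue-pascal-carryˢ k₁ k₀ s₁ k₀<e))
        qLucas (suc k₁) zero (suc s₁) zero _ _ = trans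
          (qbinom-pascal-≈ (e-1 ℕ.+ k₁ ℕ.* e) (e-1 ℕ.+ s₁ ℕ.* e)
            (qLucas k₁ e-1 (suc s₁) 0 (ℕₚ.n<1+n e-1) (s≤s z≤n))
            (^-period 0 (suc k₁))
            (qLucas (suc k₁) 0 s₁ e-1 (s≤s z≤n) (ℕₚ.n<1+n e-1)))
          (sym (lucasValue-pascal-carry² k₁ s₁))

        qbinomProduct-at-root : ∀ t bs → All (e ∣_) bs →
          evalP R (qbinomProduct (bs ++ [ e-1 ℕ.+ t ℕ.* e ])) ω ≈ natR R (binomProduct (map (_/ e) bs ++ [ t ]))
        qbinomProduct-at-root t [] [] = begin
          evalP R (qbinom (e-1 ℕ.+ t ℕ.* e) 0 ⊗ [ + 1 ]) ω   ≈⟨ evalP-⊗ R (qbinom (e-1 ℕ.+ t ℕ.* e) 0) [ + 1 ] ω ⟩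
          qbω (e-1 ℕ.+ t ℕ.* e) 0 * evalP R [ + 1 ] ω          ≈⟨ *-cong (qbinom-zeroʳ-at ω (e-1 ℕ.+ t ℕ.* e)) (evalP-1 R ω) ⟩
          1# * 1#                                              ≈⟨ *-cong (natR-1 R) (natR-1 R) ⟨
          natR R 1 * natR R 1                                  ≈⟨ natR-* R 1 1 ⟨
          natR R 1                                             ≡⟨ ≡.cong (λ x → natR R (x ℕ.* 1)) ([c+0]Cc≡1 t) ⟨
          natR R (((t ℕ.+ 0) C t) ℕ.* 1)                       ∎
        qbinomProduct-at-root t (_ ∷ bs) (divides q ≡.refl ∷ e∣bs) = begin
          evalP R (qbinom (q ℕ.* e) (sum rest) ⊗ qbinomProduct rest) ω
            ≈⟨ evalP-⊗ R (qbinom (q ℕ.* e) (sum rest)) (qbinomProduct rest) ω ⟩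
          qbω (q ℕ.* e) (sum rest) * evalP R (qbinomProduct rest) ω
            ≡⟨ ≡.cong (λ x → qbω (q ℕ.* e) x * evalP R (qbinomProduct rest) ω) (sum-digits e-1 t bs e∣bs) ⟩
          qbω (0 ℕ.+ q ℕ.* e) (e-1 ℕ.+ A ℕ.* e) * evalP R (qbinomProduct rest) ω
            ≈⟨ *-cong (qLucas q 0 A e-1 (s≤s z≤n) (ℕₚ.n<1+n e-1)) (qbinomProduct-at-root t bs e∣bs) ⟩
          (natR R ((q ℕ.+ A) C q) * qbω 0 e-1) * natR R (binomProduct rest′)
            ≈⟨ *-congʳ (trans (*-congˡ (qbinom-zeroˡ-at ω e-1)) (*-identityʳ _)) ⟩
          natR R ((q ℕ.+ A) C q) * natR R (binomProduct rest′)
            ≈⟨ natR-* R ((q ℕ.+ A) C q) (binomProduct rest′) ⟨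
          natR R (((q ℕ.+ A) C q) ℕ.* binomProduct rest′)
            ≡⟨ ≡.cong (λ x → natR R (((x ℕ.+ A) C x) ℕ.* binomProduct rest′)) (m*n/n≡m q e) ⟨
          natR R (((q ℕ.* e / e ℕ.+ A) C (q ℕ.* e / e)) ℕ.* binomProduct rest′)
            ∎
          where
          rest = bs ++ [ e-1 ℕ.+ t ℕ.* e ]
          rest′ = map (_/ e) bs ++ [ t ]
          A = sum rest′

        qbinomProduct-at-root-vanish : ∀ t bs → ¬ All (e ∣_) bs →
          evalP R (qbinomProduct (bs ++ [ e-1 ℕ.+ t ℕ.* e ])) ω ≈ 0#
        qbinomProduct-at-root-vanish t [] ¬e∣[] = ⊥-elim (¬e∣[] [])
        qbinomProduct-at-root-vanish t (b ∷ bs) ¬e∣b∷bs with all? (e ∣?_) bs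
        ... | no ¬e∣bs = trans (evalP-⊗ R (qbinom b (sum rest)) (qbinomProduct rest) ω)
            (trans (*-congˡ (qbinomProduct-at-root-vanish t bs ¬e∣bs)) (zeroʳ _))
          where rest = bs ++ [ e-1 ℕ.+ t ℕ.* e ]
        ... | yes e∣bs = trans (evalP-⊗ R (qbinom b (sum rest)) (qbinomProduct rest) ω) (trans (*-congʳ (begin
            qbω b (sum rest)                                ≡⟨ ≡.cong₂ qbω (m≡m%n+[m/n]*n b e) (sum-digits e-1 t bs e∣bs) ⟩
            qbω (b % e ℕ.+ b / e ℕ.* e) (e-1 ℕ.+ A ℕ.* e)    ≈⟨ qLucas (b / e) (b % e) A e-1 (m%n<n b e) (ℕₚ.n<1+n e-1) ⟩
            natR R ((b / e ℕ.+ A) C (b / e)) * qbω (b % e) e-1 ≈⟨ *-congˡ (qbinom-vanish-lastʳ (b % e) 0<b%e (m%n<n b e)) ⟩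
            natR R ((b / e ℕ.+ A) C (b / e)) * 0#            ≈⟨ zeroʳ _ ⟩
            0#                                              ∎)) (zeroˡ _))
          where
          rest = bs ++ [ e-1 ℕ.+ t ℕ.* e ]
          A = sum (map (_/ e) bs ++ [ t ])
          0<b%e : 0 < b % e
          0<b%e = ℕₚ.n≢0⇒n>0 (λ b%e≡0 → ¬e∣b∷bs (m%n≡0⇒n∣m b e b%e≡0 ∷ e∣bs))

module Arithmetic where

  open import Data.Nat using (zero; suc; _*_; _∸_; _%_; _/_; _≤_; _<_; z≤n; s≤s; NonZero)
  open import Data.Nat.Properties using (*-comm; 0≢1+n)
  open import Relation.Nullary using (¬_)
  open import Data.Nat.DivMod using (m%n<n)
  open import Data.Nat.Divisibility using (_∣_; divides; _∣0; ∣⇒≤; 0∣⇒≡0; n∣m⇒m%n≡0; m%n≡0⇒n∣m)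
  open import Data.Nat.Coprimality using (Coprime; coprime-divisor)
  open import Data.List using (map; upTo)
  open import Data.List.Properties using (map-∘)
  open import Data.List.Relation.Unary.All using (All)
  open import Data.List.Relation.Unary.All.Properties using (map⁺; map⁻; applyUpTo⁺₁; applyUpTo⁻)
  open import Data.Product using (∃; _,_)
  open import Data.Sum using (_⊎_; inj₁; inj₂)
  open import Relation.Binary.PropositionalEquality using (_≡_; refl; sym; trans; subst)

  even⊎odd : ∀ d → Even d ⊎ Odd d
  even⊎odd d with d % 2 | m%n<n d 2
  ... | zero | _ = inj₁ refl
  ... | suc zero | _ = inj₂ refl
  ... | suc (suc _) | s≤s (s≤s ())

  even⇒double : ∀ d-1 → Even (suc d-1) → ∃ λ e-1 → suc d-1 ≡ 2 * suc e-1
  even⇒double d-1 even with m%n≡0⇒n∣m (suc d-1) 2 even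
  ... | divides (suc e-1) d≡ = e-1 , trans d≡ (*-comm (suc e-1) 2)

  odd⇒coprime-2 : ∀ {d} → Odd d → Coprime d 2
  odd⇒coprime-2 {d} odd {i} (i∣d , i∣2) with ∣⇒≤ i∣2
  odd⇒coprime-2 {d} odd {zero} (_ , 0∣2) | _ with () ← 0∣⇒≡0 0∣2
  odd⇒coprime-2 {d} odd {suc zero} _ | _ = refl
  odd⇒coprime-2 {d} odd {suc (suc zero)} (2∣d , _) | _ with () ← trans (sym (n∣m⇒m%n≡0 d 2 2∣d)) odd
  odd⇒coprime-2 {d} odd {suc (suc (suc _))} _ | s≤s (s≤s ())

  odd-∣-double : ∀ {d x} → Odd d → d ∣ 2 * x → d ∣ x
  odd-∣-double odd = coprime-divisor (odd⇒coprime-2 odd)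

  AllDiv⇒All : ∀ {e} n ν → AllDiv e n ν → All (e ∣_) (from2 n ν)
  AllDiv⇒All n ν e∣ν = map⁺ (applyUpTo⁺₁ (λ i → i) (n ∸ 1) (λ {i} i<n-1 → e∣ν (suc (suc i)) (s≤s z≤n) (bound n i<n-1)))
    where
    bound : ∀ {i} n → i < n ∸ 1 → suc (suc i) ≤ n
    bound (suc n) i<n = s≤s i<n

  All⇒AllDiv : ∀ {e} n ν → ν 1 ≡ 0 → All (e ∣_) (from2 n ν) → AllDiv e n ν
  All⇒AllDiv {e} n ν ν₁≡0 _ (suc zero) _ _ = subst (e ∣_) (sym ν₁≡0) (e ∣0)
  All⇒AllDiv n ν _ e∣ν (suc (suc i)) _ i+2≤n = applyUpTo⁻ (λ i → i) (n ∸ 1) (map⁻ e∣ν) (bound n i+2≤n)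
    where
    bound : ∀ n → suc (suc i) ≤ n → i < n ∸ 1
    bound (suc n) (s≤s i+1≤n) = i+1≤n

  from2-/ : ∀ n ν e .{{_ : NonZero e}} → from2 n (λ i → ν i / e) ≡ map (_/ e) (from2 n ν)
  from2-/ n ν e = map-∘ (upTo (n ∸ 1))

  even⇒¬odd : ∀ d → Even d → ¬ Odd d
  even⇒¬odd _ even odd = 0≢1+n (trans (sym even) odd)

module MuAtRootsOfUnity where

  open Evaluation
  open GaussianBinomials using (qbinomProduct; qmultinom≈qbinomProduct; qint[2a]÷qint[a]; X^_)
  open Binomials using (binomProduct; multinom≡binomProduct)
  open RootsOfUnity
  open Arithmetic
  open import Level using (Level)
  open import Data.Nat as ℕ using (ℕ; suc; _≤_; _<_; _∸_; _/_; NonZero)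
  import Data.Nat.Properties as ℕₚ
  open import Data.Nat.Divisibility using (_∣_; _∣?_; divides; ∣⇒≤; *-monoʳ-∣; *-cancelˡ-∣; n∣m*n; m∣m*n; ∣-refl; n∣m⇒m%n≡0)
  open import Data.List.Relation.Unary.All using (All; all?)
  open import Data.Integer using (+_)
  open import Data.List using (List; [_]; _++_; map; upTo)
  open import Data.List.Properties using (map-cong)
  open import Data.Nat.DivMod using (/-congˡ; m*n/n≡m; m*n/m*o≡n/o)
  open import Data.Product using (∃; _×_; _,_; proj₁; proj₂)
  open import Data.Sum using (_⊎_; inj₁; inj₂)
  open import Relation.Nullary using (¬_; yes; no)
  open import Data.Empty using (⊥-elim)
  import Algebra.Properties.Ring as RingProperties
  open import Algebra.Bundles using (CommutativeRing)
  open import Relation.Binary.PropositionalEquality as ≡ using (_≡_)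

  module _ {c ℓ : Level} (R : CommutativeRing c ℓ) where

    open CommutativeRing R
    open RingProperties ring using (x∙y⁻¹≈ε⇒x≈y; x[y-z]≈xy-xz)
    open import Relation.Binary.Reasoning.Setoid setoid

    private
      _^_ : Carrier → ℕ → Carrier
      _^_ = powR R

    evalP-qint[2a]÷qint[a] : ∀ x a → 0 < a → evalP R (qint (2 ℕ.* a) ÷ qint a) x ≈ 1# + x ^ a
    evalP-qint[2a]÷qint[a] x (suc a) _ = begin
      evalP R (qint (2 ℕ.* suc a) ÷ qint (suc a)) x   ≈⟨ evalP-cong R x (qint[2a]÷qint[a] a) ⟩
      evalP R ([ + 1 ] ⊕ X^ suc a) x                  ≈⟨ evalP-⊕ R [ + 1 ] (X^ suc a) x ⟩
      evalP R [ + 1 ] x + evalP R (X^ suc a) x        ≈⟨ +-cong (evalP-1 R x) (evalP-shiftP R (suc a) [ + 1 ] x) ⟩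
      1# + x ^ suc a * evalP R [ + 1 ] x              ≈⟨ +-congˡ (trans (*-congˡ (evalP-1 R x)) (*-identityʳ _)) ⟩
      1# + x ^ suc a                                  ∎

    evalP-mu : ∀ m n ν k x → 0 < ν k →
      evalP R (mu m n ν k) x ≈ evalP R (qbinomProduct (from2 n ν ++ [ m ℕ.* (n ∸ 1) ])) (x * x) * (1# + x ^ ν k)
    evalP-mu m n ν k x 0<νk = begin
      evalP R (sqP (qmultinom as) ⊗ (qint (2 ℕ.* ν k) ÷ qint (ν k))) x
        ≈⟨ evalP-⊗ R (sqP (qmultinom as)) _ x ⟩
      evalP R (sqP (qmultinom as)) x * evalP R (qint (2 ℕ.* ν k) ÷ qint (ν k)) x
        ≈⟨ *-cong (trans (evalP-sqP R (qmultinom as) x) (evalP-cong R (x * x) (qmultinom≈qbinomProduct as)))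
                  (evalP-qint[2a]÷qint[a] x (ν k) 0<νk) ⟩
      evalP R (qbinomProduct as) (x * x) * (1# + x ^ ν k)
        ∎
      where as = from2 n ν ++ [ m ℕ.* (n ∸ 1) ]

    square-primitiveRoot : ∀ {d e ζ} .{{_ : NonZero d}} .{{_ : NonZero e}} → PrimitiveRoot R d ζ →
                           d ∣ 2 ℕ.* e → (∀ j → d ∣ 2 ℕ.* j → e ∣ j) → PrimitiveRoot R e (ζ * ζ)
    square-primitiveRoot {suc d-1} {suc e-1} {ζ} root d∣2e d∣2j⇒e∣j =
      trans (square-^ R ζ (suc e-1)) (∣⇒^≈1 R d-1 root d∣2e) ,
      λ j 0<j j<e ζ²ʲ≈1 → ℕₚ.<⇒≱ j<e (∣⇒≤ {{ℕ.>-nonZero 0<j}}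
        (d∣2j⇒e∣j j (^≈1⇒∣ R d-1 root (2 ℕ.* j) (trans (sym (square-^ R ζ j)) ζ²ʲ≈1))))

    1+^≈2 : ∀ {d ζ a} .{{_ : NonZero d}} → PrimitiveRoot R d ζ → d ∣ a → 1# + ζ ^ a ≈ natR R 2
    1+^≈2 {suc d-1} root d∣a = trans (+-congˡ (∣⇒^≈1 R d-1 root d∣a)) (+-congˡ (sym (natR-1 R)))

    -- (1 + ζᵃ)(ζᵃ - 1) = ζ²ᵃ - 1 = 0, and ζᵃ - 1 ≠ 0 because d ∤ a
    1+^≈0 : (∀ a b → a * b ≈ 0# → a ≈ 0# ⊎ b ≈ 0#) → ∀ {d ζ a} .{{_ : NonZero d}} → PrimitiveRoot R d ζ →
            d ∣ 2 ℕ.* a → ¬ d ∣ a → 1# + ζ ^ a ≈ 0#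
    1+^≈0 no-zero-divisors {suc d-1} {ζ} {a} root d∣2a d∤a with no-zero-divisors _ _ [1+ζᵃ][ζᵃ-1]≈0
      where
      x = ζ ^ a
      xx≈1 : x * x ≈ 1#
      xx≈1 = trans (sym (^-*-distrib R ζ ζ a)) (trans (square-^ R ζ a) (∣⇒^≈1 R d-1 root d∣2a))
      [1+ζᵃ][ζᵃ-1]≈0 : (1# + x) * (x - 1#) ≈ 0#
      [1+ζᵃ][ζᵃ-1]≈0 = begin
        (1# + x) * (x - 1#)               ≈⟨ x[y-z]≈xy-xz (1# + x) x 1# ⟩
        (1# + x) * x - (1# + x) * 1#      ≈⟨ +-cong (trans (distribʳ x 1# x) (trans (+-cong (*-identityˡ x) xx≈1) (+-comm x 1#)))
                                                   (-‿cong (*-identityʳ _)) ⟩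
        (1# + x) - (1# + x)               ≈⟨ -‿inverseʳ _ ⟩
        0#                                ∎
    ... | inj₁ 1+ζᵃ≈0 = 1+ζᵃ≈0
    ... | inj₂ ζᵃ-1≈0 = ⊥-elim (d∤a (^≈1⇒∣ R d-1 root a (x∙y⁻¹≈ε⇒x≈y (ζ ^ a) 1# ζᵃ-1≈0)))

  ∣suc⇒digits : ∀ e-1 x → suc e-1 ∣ suc x → ∃ λ t → x ≡ e-1 ℕ.+ t ℕ.* suc e-1
  ∣suc⇒digits e-1 x (divides (suc t) 1+x≡) = t , ℕₚ.suc-injective 1+x≡

  digits-quotient : ∀ e-1 t x → x ≡ e-1 ℕ.+ t ℕ.* suc e-1 → (x ℕ.+ 1) / suc e-1 ∸ 1 ≡ t
  digits-quotient e-1 t x x≡ = ≡.cong (_∸ 1)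
    (≡.trans (/-congˡ (≡.trans (≡.cong (ℕ._+ 1) x≡) (ℕₚ.+-comm _ 1))) (m*n/n≡m (suc t) (suc e-1)))

  value1≡ : ∀ m n ν d-1 t → m ℕ.* (n ∸ 1) ≡ d-1 ℕ.+ t ℕ.* suc d-1 →
            value1 m n ν (suc d-1) ≡ 2 ℕ.* binomProduct (map (_/ suc d-1) (from2 n ν) ++ [ t ])
  value1≡ m n ν d-1 t M≡ = ≡.cong (2 ℕ.*_) (≡.trans (multinom≡binomProduct (from2 n (λ i → ν i / suc d-1) ++ _))
    (≡.cong₂ (λ xs y → binomProduct (xs ++ [ y ])) (from2-/ n ν (suc d-1)) (digits-quotient d-1 t _ M≡)))

  value2≡ : ∀ m n ν e-1 t → m ℕ.* (n ∸ 1) ≡ e-1 ℕ.+ t ℕ.* suc e-1 →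
            value2 m n ν (2 ℕ.* suc e-1) ≡ 2 ℕ.* binomProduct (map (_/ suc e-1) (from2 n ν) ++ [ t ])
  value2≡ m n ν e-1 t M≡ = ≡.cong (2 ℕ.*_) (≡.trans (multinom≡binomProduct (from2 n (λ i → 2 ℕ.* ν i / (2 ℕ.* suc e-1)) ++ _))
    (≡.cong₂ (λ xs y → binomProduct (xs ++ [ y ])) entries≡ last≡))
    where
    e = suc e-1
    M = m ℕ.* (n ∸ 1)
    entries≡ : from2 n (λ i → 2 ℕ.* ν i / (2 ℕ.* e)) ≡ map (_/ e) (from2 n ν)
    entries≡ = ≡.trans (map-cong (λ i → m*n/m*o≡n/o 2 (ν (suc (suc i))) e) (upTo (n ∸ 1))) (from2-/ n ν e)
    last≡ : (2 ℕ.* M ℕ.+ 2) / (2 ℕ.* e) ∸ 1 ≡ t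
    last≡ = ≡.trans (≡.cong (λ x → x / (2 ℕ.* e) ∸ 1) (≡.sym (ℕₚ.*-distribˡ-+ 2 M 1)))
              (≡.trans (≡.cong (_∸ 1) (m*n/m*o≡n/o 2 (M ℕ.+ 1) e)) (digits-quotient e-1 t M M≡))

  module _ {c ℓ : Level} (R : CommutativeRing c ℓ) (domain : DomainChar0 R)
           (m n : ℕ) (ν : ℕ → ℕ) (k : ℕ) (ν₁≡0 : ν 1 ≡ 0) (1≤k : 1 ≤ k) (k≤n : k ≤ n) (0<νk : 0 < ν k) where

    open CommutativeRing R
    open import Relation.Binary.Reasoning.Setoid setoid

    private
      _^_ : Carrier → ℕ → Carrier
      _^_ = powR R

      M : ℕ
      M = m ℕ.* (n ∸ 1)

      L : List ℕ
      L = from2 n ν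

      no-zero-divisors : ∀ a b → a * b ≈ 0# → a ≈ 0# ⊎ b ≈ 0#
      no-zero-divisors = proj₁ domain

      1≉0 : ¬ 1# ≈ 0#
      1≉0 1≈0 with () ← proj₂ domain 1 (trans (natR-1 R) 1≈0)

      2M+2≡2[1+M] : 2 ℕ.* M ℕ.+ 2 ≡ 2 ℕ.* suc M
      2M+2≡2[1+M] = ≡.trans (ℕₚ.+-comm (2 ℕ.* M) 2) (≡.sym (ℕₚ.*-suc 2 M))

      natR-doubled : ∀ B {V} → V ≡ 2 ℕ.* B → natR R B * natR R 2 ≈ natR R V
      natR-doubled B V≡ = trans (sym (natR-* R B 2)) (reflexive (≡.cong (natR R) (≡.trans (ℕₚ.*-comm B 2) (≡.sym V≡))))

    Lemma8p1Cases : (d : ℕ) .{{_ : NonZero d}} → Carrier → Set ℓ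
    Lemma8p1Cases d ζ =
      (Case1 m n ν k d → evalP R (mu m n ν k) ζ ≈ natR R (value1 m n ν d)) ×
      (Case2 m n ν k d → evalP R (mu m n ν k) ζ ≈ natR R (value2 m n ν d)) ×
      (¬ Case1 m n ν k d → ¬ Case2 m n ν k d → evalP R (mu m n ν k) ζ ≈ 0#)

    module _ (e-1 t : ℕ) (M≡ : M ≡ e-1 ℕ.+ t ℕ.* suc e-1)
             {ζ : Carrier} (ω-root : PrimitiveRoot R (suc e-1) (ζ * ζ)) where

      private
        evalP-mu-digits : evalP R (mu m n ν k) ζ ≈
                          evalP R (qbinomProduct (L ++ [ e-1 ℕ.+ t ℕ.* suc e-1 ])) (ζ * ζ) * (1# + ζ ^ ν k)
        evalP-mu-digits = trans (evalP-mu R m n ν k ζ 0<νk)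
          (reflexive (≡.cong (λ x → evalP R (qbinomProduct (L ++ [ x ])) (ζ * ζ) * (1# + ζ ^ ν k)) M≡))

      evalP-mu-divisible : All (suc e-1 ∣_) L →
        evalP R (mu m n ν k) ζ ≈ natR R (binomProduct (map (_/ suc e-1) L ++ [ t ])) * (1# + ζ ^ ν k)
      evalP-mu-divisible e∣L =
        trans evalP-mu-digits (*-congʳ (qbinomProduct-at-root R e-1 ω-root no-zero-divisors 1≉0 t L e∣L))

      evalP-mu-vanish : ¬ All (suc e-1 ∣_) L → evalP R (mu m n ν k) ζ ≈ 0#
      evalP-mu-vanish ¬e∣L =
        trans evalP-mu-digits
              (trans (*-congʳ (qbinomProduct-at-root-vanish R e-1 ω-root no-zero-divisors 1≉0 t L ¬e∣L)) (zeroˡ _))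

    evalP-mu-odd : ∀ d-1 {ζ} → Odd (suc d-1) → suc d-1 ∣ 2 ℕ.* M ℕ.+ 2 → PrimitiveRoot R (suc d-1) ζ →
                   Lemma8p1Cases (suc d-1) ζ
    evalP-mu-odd d-1 {ζ} odd d∣2M+2 root
      with ∣suc⇒digits d-1 M (odd-∣-double odd (≡.subst (suc d-1 ∣_) 2M+2≡2[1+M] d∣2M+2))
    ... | t , M≡ = case1 , case2 , neither
      where
      d = suc d-1
      ω-root : PrimitiveRoot R d (ζ * ζ)
      ω-root = square-primitiveRoot R root (n∣m*n 2) (λ _ → odd-∣-double odd)
      case1 : Case1 m n ν k d → evalP R (mu m n ν k) ζ ≈ natR R (value1 m n ν d)
      case1 (_ , d∣ν) = begin
        evalP R (mu m n ν k) ζ      ≈⟨ evalP-mu-divisible d-1 t M≡ ω-root (AllDiv⇒All n ν d∣ν) ⟩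
        natR R B * (1# + ζ ^ ν k)   ≈⟨ *-congˡ (1+^≈2 R root (d∣ν k 1≤k k≤n)) ⟩
        natR R B * natR R 2         ≈⟨ natR-doubled B (value1≡ m n ν d-1 t M≡) ⟩
        natR R (value1 m n ν d)     ∎
        where B = binomProduct (map (_/ d) L ++ [ t ])
      case2 : Case2 m n ν k d → evalP R (mu m n ν k) ζ ≈ natR R (value2 m n ν d)
      case2 (even , _) = ⊥-elim (even⇒¬odd d even odd)
      neither : ¬ Case1 m n ν k d → ¬ Case2 m n ν k d → evalP R (mu m n ν k) ζ ≈ 0#
      neither ¬case1 _ = evalP-mu-vanish d-1 t M≡ ω-root (λ d∣L → ¬case1 (odd , All⇒AllDiv n ν ν₁≡0 d∣L))

    evalP-mu-even : ∀ e-1 {ζ} → 2 ℕ.* suc e-1 ∣ 2 ℕ.* M ℕ.+ 2 → PrimitiveRoot R (2 ℕ.* suc e-1) ζ →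
                    Lemma8p1Cases (2 ℕ.* suc e-1) ζ
    evalP-mu-even e-1 {ζ} d∣2M+2 root
      with ∣suc⇒digits e-1 M (*-cancelˡ-∣ 2 (≡.subst (2 ℕ.* suc e-1 ∣_) 2M+2≡2[1+M] d∣2M+2))
    ... | t , M≡ = case1 , case2 , neither
      where
      e = suc e-1
      d = 2 ℕ.* e
      d/2≡e : d / 2 ≡ e
      d/2≡e = ≡.trans (≡.cong (_/ 2) (ℕₚ.*-comm 2 e)) (m*n/n≡m e 2)
      even : Even d
      even = n∣m⇒m%n≡0 d 2 (m∣m*n e)
      ω-root : PrimitiveRoot R e (ζ * ζ)
      ω-root = square-primitiveRoot R root ∣-refl (λ _ → *-cancelˡ-∣ 2)
      case1 : Case1 m n ν k d → evalP R (mu m n ν k) ζ ≈ natR R (value1 m n ν d)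
      case1 (odd , _) = ⊥-elim (even⇒¬odd d even odd)
      case2 : Case2 m n ν k d → evalP R (mu m n ν k) ζ ≈ natR R (value2 m n ν d)
      case2 (_ , d/2∣ν , d∣νk) = begin
        evalP R (mu m n ν k) ζ      ≈⟨ evalP-mu-divisible e-1 t M≡ ω-root (AllDiv⇒All n ν (≡.subst (λ x → AllDiv x n ν) d/2≡e d/2∣ν)) ⟩
        natR R B * (1# + ζ ^ ν k)   ≈⟨ *-congˡ (1+^≈2 R root d∣νk) ⟩
        natR R B * natR R 2         ≈⟨ natR-doubled B (value2≡ m n ν e-1 t M≡) ⟩
        natR R (value2 m n ν d)     ∎
        where B = binomProduct (map (_/ e) L ++ [ t ])
      neither : ¬ Case1 m n ν k d → ¬ Case2 m n ν k d → evalP R (mu m n ν k) ζ ≈ 0#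
      neither _ ¬case2 with all? (e ∣?_) L
      ... | no ¬e∣L = evalP-mu-vanish e-1 t M≡ ω-root ¬e∣L
      ... | yes e∣L = trans (evalP-mu-divisible e-1 t M≡ ω-root e∣L)
                        (trans (*-congˡ (1+^≈0 R no-zero-divisors root (*-monoʳ-∣ 2 (e∣ν k 1≤k k≤n)) d∤νk)) (zeroʳ _))
        where
        e∣ν : AllDiv e n ν
        e∣ν = All⇒AllDiv n ν ν₁≡0 e∣L
        d∤νk : ¬ d ∣ ν k
        d∤νk d∣νk = ¬case2 (even , ≡.subst (λ x → AllDiv x n ν) (≡.sym d/2≡e) e∣ν , d∣νk)

    evalP-mu-at-primitiveRoot : ∀ d-1 {ζ} → suc d-1 ∣ 2 ℕ.* M ℕ.+ 2 → PrimitiveRoot R (suc d-1) ζ →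
                                Lemma8p1Cases (suc d-1) ζ
    evalP-mu-at-primitiveRoot d-1 d∣2M+2 root with even⊎odd (suc d-1)
    ... | inj₂ odd = evalP-mu-odd d-1 odd d∣2M+2 root
    ... | inj₁ even with even⇒double d-1 even
    ...   | e-1 , ≡.refl = evalP-mu-even e-1 d∣2M+2 root

open MuAtRootsOfUnity
open import Level using (Level)
open import Data.Nat using (ℕ; _*_; _+_; _∸_; _≤_; _<_; NonZero; suc; s≤s; z≤n)
open import Data.Nat.Properties using (≤-trans)
open import Data.Nat.Divisibility using (_∣_)
open import Data.Product using (_×_)
open import Relation.Nullary using (¬_)
open import Relation.Binary.PropositionalEquality using (_≡_)
open import Algebra.Bundles using (CommutativeRing)

-- Of the hypotheses on λ and k only n_1 = 0, 1 ≤ k ≤ n and n_k > 0 enter the computation.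
lemma8p1 : {c ℓ : Level} (R : CommutativeRing c ℓ) → DomainChar0 R →
    (m n : ℕ) → 1 ≤ m → 1 ≤ n →
    (ν : ℕ → ℕ) → sumFrom1 n (λ i → i * ν i) ≡ n → ν 1 ≡ 0 →
    (k : ℕ) → Odd k → 3 ≤ k → k ≤ n → 0 < ν k →
    ((j : ℕ) → Odd j → 3 ≤ j → j ≤ n → 0 < ν j → j ≡ k) →
    (d : ℕ) .{{_ : NonZero d}} → d ∣ 2 * (m * (n ∸ 1)) + 2 →
    (ζ : CommutativeRing.Carrier R) → PrimitiveRoot R d ζ →
    (Case1 m n ν k d →
      CommutativeRing._≈_ R (evalP R (mu m n ν k) ζ) (natR R (value1 m n ν d)))
    × (Case2 m n ν k d →
      CommutativeRing._≈_ R (evalP R (mu m n ν k) ζ) (natR R (value2 m n ν d)))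
    × (¬ Case1 m n ν k d → ¬ Case2 m n ν k d →
      CommutativeRing._≈_ R (evalP R (mu m n ν k) ζ) (CommutativeRing.0# R))
lemma8p1 R domain m n _ _ ν _ ν₁≡0 k _ 3≤k k≤n 0<νk _ (suc d-1) d∣2M+2 ζ root =
  evalP-mu-at-primitiveRoot R domain m n ν k ν₁≡0 (≤-trans (s≤s z≤n) 3≤k) k≤n 0<νk d-1 d∣2M+2 root
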